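{- Let $n \geq 4$, $m = n-2$, and $C = \{1,\ldots,n-2\}^3 \subseteq [n]^3$. For $q \in [n]^3$ let $\kappa(q) = |N[q] \cap C|$, where $N[q]$ is the closed neighbourhood of $q$ in the 3D queen graph $Q^3_n$. Then: (i) If $q$ is a corner vertex, then $\kappa(q) = m$. (ii) If $q$ lies on an edge but not at a corner, then $\kappa(q) = 2m-1$. (iii) If $q$ lies on a face but not on any edge, then $\kappa(q) \leq 5m-4-\varepsilon_m$, where $\varepsilon_m = (m-1) \bmod 2$, with equality when $q$ is the face centre and the face centre is a lattice point, which occurs precisely when $m$ is odd. (iv) If $q \in C$, then $\kappa(q) \leq 13m-12$, with equality when $q$ is the centre $\left(\tfrac{n-1}{2},\tfrac{n-1}{2},\tfrac{n-1}{2}\right)$ of the board (when this is a lattice point). In particular, $\max_{q \in \partial[n]^3} \kappa(q) < \max_{q \in C} \kappa(q)$ for all $n \geq 4$, where $\partial[n]^3 = [n]^3 \setminus C$.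
   Context: $[n] = \{0,1,\ldots,n-1\}$. The 3D queen graph $Q^3_n$ has vertex set $[n]^3$; two distinct vertices $v,w$ are adjacent iff $w - v$ is a nonzero integer multiple of one of the 13 direction vectors $(1,0,0),(0,1,0),(0,0,1)$, $(1,\pm1,0),(1,0,\pm1),(0,1,\pm1)$, $(1,\pm1,\pm1)$ (i.e., reachable by a 3D queen move along an axis, face diagonal, or space diagonal). $N[v] = \{v\} \cup \{w : w \sim v\}$. Call a coordinate extreme if it lies in $\{0,n-1\}$. A corner vertex has all three coordinates extreme; an edge vertex has at least two coordinates extreme (a non-corner edge vertex exactly two); a face vertex has at least one extreme coordinate, and a face vertex not on any edge has exactly one extreme coordinate. The face centre of such a face is the point whose two non-extreme coordinates both equal $(n-1)/2$. -}

module Defs where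

open import Data.Nat as ℕ using (ℕ; zero; suc; _≤_; _<_; _∸_; _+_)
open import Data.Integer as ℤ using (ℤ; +_; _-_; _*_; 0ℤ; 1ℤ; -1ℤ)
open import Data.Integer.Properties using (*-identityʳ)
open import Data.Product using (_×_; _,_; proj₁; proj₂; ∃-syntax)
open import Data.Product.Properties using (≡-dec)
open import Data.Sum using (_⊎_; inj₁; inj₂)
open import Data.List using (List; []; _∷_; map; concatMap; filter; length; upTo)
open import Data.List.Relation.Unary.Any using (Any; here; there)
open import Relation.Binary.PropositionalEquality using (_≡_; _≢_; refl; sym; trans; cong)
open import Relation.Nullary using (Dec; yes; no; ¬_)
open import Relation.Nullary.Decidable using (_⊎-dec_; _×-dec_; ¬?)

Pt : Set
Pt = ℕ × ℕ × ℕ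

Vec3 : Set
Vec3 = ℤ × ℤ × ℤ

InBoard : ℕ → Pt → Set
InBoard n (a , b , c) = a < n × b < n × c < n

dirs : List Vec3
dirs = (1ℤ , 0ℤ , 0ℤ) ∷ (0ℤ , 1ℤ , 0ℤ) ∷ (0ℤ , 0ℤ , 1ℤ)
     ∷ (1ℤ , 1ℤ , 0ℤ) ∷ (1ℤ , -1ℤ , 0ℤ)
     ∷ (1ℤ , 0ℤ , 1ℤ) ∷ (1ℤ , 0ℤ , -1ℤ)
     ∷ (0ℤ , 1ℤ , 1ℤ) ∷ (0ℤ , 1ℤ , -1ℤ)
     ∷ (1ℤ , 1ℤ , 1ℤ) ∷ (1ℤ , 1ℤ , -1ℤ) ∷ (1ℤ , -1ℤ , 1ℤ) ∷ (1ℤ , -1ℤ , -1ℤ)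
     ∷ []

_⊖_ : Pt → Pt → Vec3
(w₁ , w₂ , w₃) ⊖ (v₁ , v₂ , v₃) = (+ w₁ - + v₁ , + w₂ - + v₂ , + w₃ - + v₃)

_·_ : ℤ → Vec3 → Vec3
k · (a , b , c) = (k * a , k * b , k * c)

NonzeroMultipleOf : Vec3 → Vec3 → Set
NonzeroMultipleOf t d = ∃[ k ] (k ≢ 0ℤ × t ≡ k · d)

Adjacent : Pt → Pt → Set
Adjacent v w = v ≢ w × Any (NonzeroMultipleOf (w ⊖ v)) dirs

InClosedNbhd : Pt → Pt → Set
InClosedNbhd v w = w ≡ v ⊎ Adjacent v w

_≟P_ : (p q : Pt) → Dec (p ≡ q)
_≟P_ = ≡-dec ℕ._≟_ (≡-dec ℕ._≟_ ℕ._≟_)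

_≟V_ : (p q : Vec3) → Dec (p ≡ q)
_≟V_ = ≡-dec ℤ._≟_ (≡-dec ℤ._≟_ ℤ._≟_)

dec₁ : ∀ t₁ t₂ t₃ d₂ d₃ → Dec (NonzeroMultipleOf (t₁ , t₂ , t₃) (1ℤ , d₂ , d₃))
dec₁ t₁ t₂ t₃ d₂ d₃ with t₁ ℤ.≟ 0ℤ | (t₁ , t₂ , t₃) ≟V (t₁ · (1ℤ , d₂ , d₃))
... | yes z | _ = no λ { (k , k≢0 , eq) → k≢0 (trans (sym (trans (cong proj₁ eq) (*-identityʳ k))) z) }
... | no nz | yes eq = yes (t₁ , nz , eq)
... | no nz | no neq = no λ { (k , k≢0 , eq) →
        neq (trans eq (cong (_· (1ℤ , d₂ , d₃)) (sym (trans (cong proj₁ eq) (*-identityʳ k))))) }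

dec₂ : ∀ t₁ t₂ t₃ d₁ d₃ → Dec (NonzeroMultipleOf (t₁ , t₂ , t₃) (d₁ , 1ℤ , d₃))
dec₂ t₁ t₂ t₃ d₁ d₃ with t₂ ℤ.≟ 0ℤ | (t₁ , t₂ , t₃) ≟V (t₂ · (d₁ , 1ℤ , d₃))
... | yes z | _ = no λ { (k , k≢0 , eq) → k≢0 (trans (sym (trans (cong (λ x → proj₁ (proj₂ x)) eq) (*-identityʳ k))) z) }
... | no nz | yes eq = yes (t₂ , nz , eq)
... | no nz | no neq = no λ { (k , k≢0 , eq) →
        neq (trans eq (cong (_· (d₁ , 1ℤ , d₃)) (sym (trans (cong (λ x → proj₁ (proj₂ x)) eq) (*-identityʳ k))))) }

dec₃ : ∀ t₁ t₂ t₃ d₁ d₂ → Dec (NonzeroMultipleOf (t₁ , t₂ , t₃) (d₁ , d₂ , 1ℤ))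
dec₃ t₁ t₂ t₃ d₁ d₂ with t₃ ℤ.≟ 0ℤ | (t₁ , t₂ , t₃) ≟V (t₃ · (d₁ , d₂ , 1ℤ))
... | yes z | _ = no λ { (k , k≢0 , eq) → k≢0 (trans (sym (trans (cong (λ x → proj₂ (proj₂ x)) eq) (*-identityʳ k))) z) }
... | no nz | yes eq = yes (t₃ , nz , eq)
... | no nz | no neq = no λ { (k , k≢0 , eq) →
        neq (trans eq (cong (_· (d₁ , d₂ , 1ℤ)) (sym (trans (cong (λ x → proj₂ (proj₂ x)) eq) (*-identityʳ k))))) }

anyCons : ∀ {P : Vec3 → Set} {x xs} → Dec (P x) → Dec (Any P xs) → Dec (Any P (x ∷ xs))
anyCons (yes p) _ = yes (here p)
anyCons (no ¬p) (yes q) = yes (there q)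
anyCons (no ¬p) (no ¬q) = no λ { (here p) → ¬p p ; (there q) → ¬q q }

decDirs : ∀ t → Dec (Any (NonzeroMultipleOf t) dirs)
decDirs (t₁ , t₂ , t₃) =
  anyCons (dec₁ t₁ t₂ t₃ 0ℤ 0ℤ) (anyCons (dec₂ t₁ t₂ t₃ 0ℤ 0ℤ) (anyCons (dec₃ t₁ t₂ t₃ 0ℤ 0ℤ)
  (anyCons (dec₁ t₁ t₂ t₃ 1ℤ 0ℤ) (anyCons (dec₁ t₁ t₂ t₃ -1ℤ 0ℤ)
  (anyCons (dec₁ t₁ t₂ t₃ 0ℤ 1ℤ) (anyCons (dec₁ t₁ t₂ t₃ 0ℤ -1ℤ)
  (anyCons (dec₂ t₁ t₂ t₃ 0ℤ 1ℤ) (anyCons (dec₂ t₁ t₂ t₃ 0ℤ -1ℤ)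
  (anyCons (dec₁ t₁ t₂ t₃ 1ℤ 1ℤ) (anyCons (dec₁ t₁ t₂ t₃ 1ℤ -1ℤ)
  (anyCons (dec₁ t₁ t₂ t₃ -1ℤ 1ℤ) (anyCons (dec₁ t₁ t₂ t₃ -1ℤ -1ℤ)
  (no λ ())))))))))))))

inClosedNbhd? : ∀ v w → Dec (InClosedNbhd v w)
inClosedNbhd? v w = (w ≟P v) ⊎-dec (¬? (v ≟P w) ×-dec decDirs (w ⊖ v))

-- The inner cube C = {1,…,n-2}³, as a (duplicate-free) list

inner : ℕ → List ℕ
inner n = map suc (upTo (n ∸ 2))

cubeList : ℕ → List Pt
cubeList n = concatMap (λ a → concatMap (λ b → map (λ c → (a , b , c)) (inner n)) (inner n)) (inner n)

InC : ℕ → Pt → Set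
InC n (a , b , c) = (1 ≤ a × a ≤ n ∸ 2) × (1 ≤ b × b ≤ n ∸ 2) × (1 ≤ c × c ≤ n ∸ 2)

κ : ℕ → Pt → ℕ
κ n q = length (filter (inClosedNbhd? q) (cubeList n))

Extreme : ℕ → ℕ → Set
Extreme n x = x ≡ 0 ⊎ x ≡ n ∸ 1

extreme? : ∀ n x → Dec (Extreme n x)
extreme? n x = (x ℕ.≟ 0) ⊎-dec (x ℕ.≟ n ∸ 1)

ind : ∀ {A : Set} → Dec A → ℕ
ind (yes _) = 1
ind (no _) = 0

numExtreme : ℕ → Pt → ℕ
numExtreme n (a , b , c) = ind (extreme? n a) + ind (extreme? n b) + ind (extreme? n c)

Corner : ℕ → Pt → Set
Corner n (a , b , c) = Extreme n a × Extreme n b × Extreme n c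

IsFaceCentre : ℕ → Pt → Set
IsFaceCentre n (a , b , c) =
  numExtreme n (a , b , c) ≡ 1 ×
  (Extreme n a ⊎ 2 ℕ.* a ≡ n ∸ 1) × (Extreme n b ⊎ 2 ℕ.* b ≡ n ∸ 1) × (Extreme n c ⊎ 2 ℕ.* c ≡ n ∸ 1)

{-# OPTIONS --safe #-}

-- Write q = (x₁, x₂, x₃) and m = n − 2.  A point w ≠ q is a queen move away from q iff there is a
-- k ≥ 1 with wᵢ ∈ {xᵢ, xᵢ + k, xᵢ − k} for every i, and this k is then unique (it is the Chebyshev
-- distance).  Sorting the points of C by k therefore factorises the count over the coordinates:
--
--   κ(q) + m·[q ∈ C] = [q ∈ C] + Σ_{k=1}^{m} r(x₁,k) r(x₂,k) r(x₃,k),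
--
-- where r(x,k) = #{a ∈ [1,m] : a ∈ {x, x ± k}} is 1 for an extreme x and
-- 1 + [k ≤ A] + [k ≤ B] for an interior x, with A = m − x and B = x − 1 the numbers of cells above
-- and below x (so A + B = m − 1).  Corners and edges are then direct evaluations.  For a face the
-- sum is m + 2(m − 1) + (A₁⊓A₂ + B₁⊓B₂) + (A₁⊓B₂ + B₁⊓A₂), and each bracket equals
-- m − 1 − |A₁ − A₂| resp. m − 1 − |A₁ − B₂|; both defects vanish only if A₁ = A₂ = B₂, which needs
-- m − 1 even.  For q ∈ C the pointwise bound (1+a)(1+b)(1+c) ≤ 1 + 5a + 4b + 4c on {0,1,2}³ gives
-- 13m − 12, attained at the centre; and (1,1,1) ∈ C already beats every boundary point.

module Submission where

open import Defs
open import Data.Nat using (ℕ; zero; suc; z≤n; s≤s; _≤_; _<_; _∸_; _+_; _*_; _%_; _/_; _⊓_; _≤?_; ∣_-_∣)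
  renaming (_≟_ to _≟ℕ_)
open import Data.Nat.Properties
open import Data.Nat.DivMod using (m*n%n≡0; m%n<n; [m+kn]%n≡m%n; m≡m%n+[m/n]*n)
open import Data.Nat.ListAction using (sum)
open import Data.Nat.ListAction.Properties using (sum-++)
open import Data.Nat.Tactic.RingSolver using (solve-∀)
open import Data.Integer as ℤ using (ℤ; +_; -[1+_]; 0ℤ; 1ℤ; -1ℤ; ∣_∣)
import Data.Integer.Properties as ℤ
import Data.Integer.Tactic.RingSolver as ℤ-Solver
open import Data.List using (List; []; _∷_; [_]; _++_; map; concatMap; filter; length; upTo)
open import Data.List.Properties using (map-++; map-∘; applyUpTo-∷ʳ)
open import Data.List.Membership.DecPropositional ℤ._≟_ using (_∈_; _∈?_)
open import Data.List.Relation.Unary.All as All using (All; all?; lookupAny)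
open import Data.List.Relation.Unary.Any as Any using (Any; here; there; any?)
open import Data.Product using (_×_; _,_; proj₁; proj₂; ∃-syntax)
open import Data.Sum using (_⊎_; inj₁; inj₂; [_,_]′)
open import Data.Empty using (⊥-elim)
open import Data.Unit using (⊤; tt)
open import Function using (_∘_; id)
open import Function.Bundles using (_⇔_; mk⇔)
open import Relation.Binary.PropositionalEquality
  using (_≡_; _≢_; ≢-sym; refl; sym; trans; cong; cong₂; subst; module ≡-Reasoning)
open import Relation.Nullary using (¬_; Dec; yes; no)
open import Relation.Nullary.Decidable using (toWitness; _×-dec_; _⊎-dec_; _→-dec_; ¬?)

private variable
  A B : Set

-- Indicators and finite sums

ind-yes : (A? : Dec A) → A → ind A? ≡ 1
ind-yes (yes _) _ = refl
ind-yes (no ¬a) a = ⊥-elim (¬a a)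

ind-no : (A? : Dec A) → ¬ A → ind A? ≡ 0
ind-no (yes a) ¬a = ⊥-elim (¬a a)
ind-no (no _)  _  = refl

ind-cong : (A? : Dec A) (B? : Dec B) → (A → B) → (B → A) → ind A? ≡ ind B?
ind-cong (yes a) B? to from = sym (ind-yes B? (to a))
ind-cong (no ¬a) B? to from = sym (ind-no B? (¬a ∘ from))

⟦_≤_⟧ : ℕ → ℕ → ℕ
⟦ k ≤ A ⟧ = ind (k ≤? A)

⟦≤⟧≤1 : ∀ k A → ⟦ k ≤ A ⟧ ≤ 1
⟦≤⟧≤1 k A with k ≤? A
... | yes _ = ≤-refl
... | no  _ = z≤n

⟦≤⟧-*-⊓ : ∀ k A B → ⟦ k ≤ A ⟧ * ⟦ k ≤ B ⟧ ≡ ⟦ k ≤ A ⊓ B ⟧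
⟦≤⟧-*-⊓ k A B with k ≤? A | k ≤? B
... | yes k≤A | yes k≤B = sym (ind-yes (k ≤? A ⊓ B) (⊓-glb k≤A k≤B))
... | yes _   | no k≰B  = sym (ind-no (k ≤? A ⊓ B) (k≰B ∘ (λ k≤A⊓B → ≤-trans k≤A⊓B (m⊓n≤n A B))))
... | no k≰A  | _       = sym (ind-no (k ≤? A ⊓ B) (k≰A ∘ (λ k≤A⊓B → ≤-trans k≤A⊓B (m⊓n≤m A B))))

-- ∑ n f = f 1 + ⋯ + f n: the index starts at 1.
∑ : ℕ → (ℕ → ℕ) → ℕ
∑ zero    f = 0
∑ (suc n) f = ∑ n f + f (suc n)

∑-cong : ∀ n {f g : ℕ → ℕ} → (∀ k → 1 ≤ k → k ≤ n → f k ≡ g k) → ∑ n f ≡ ∑ n g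
∑-cong zero    eq = refl
∑-cong (suc n) eq = cong₂ _+_ (∑-cong n (λ k 1≤k k≤n → eq k 1≤k (m≤n⇒m≤1+n k≤n))) (eq (suc n) (s≤s z≤n) ≤-refl)

∑-mono-≤ : ∀ n {f g : ℕ → ℕ} → (∀ k → 1 ≤ k → k ≤ n → f k ≤ g k) → ∑ n f ≤ ∑ n g
∑-mono-≤ zero    le = z≤n
∑-mono-≤ (suc n) le = +-mono-≤ (∑-mono-≤ n (λ k 1≤k k≤n → le k 1≤k (m≤n⇒m≤1+n k≤n))) (le (suc n) (s≤s z≤n) ≤-refl)

∑-const : ∀ n c → ∑ n (λ _ → c) ≡ n * c
∑-const zero    c = refl
∑-const (suc n) c = trans (cong (_+ c) (∑-const n c)) (+-comm (n * c) c)

∑-zero : ∀ n {f : ℕ → ℕ} → (∀ k → 1 ≤ k → k ≤ n → f k ≡ 0) → ∑ n f ≡ 0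
∑-zero n eq = trans (∑-cong n eq) (trans (∑-const n 0) (*-zeroʳ n))

∑-+ : ∀ n (f g : ℕ → ℕ) → ∑ n (λ k → f k + g k) ≡ ∑ n f + ∑ n g
∑-+ zero    f g = refl
∑-+ (suc n) f g = trans (cong (_+ (f (suc n) + g (suc n))) (∑-+ n f g)) (+-+-comm (∑ n f) (∑ n g) _ _)
  where
  +-+-comm : ∀ a b c d → (a + b) + (c + d) ≡ (a + c) + (b + d)
  +-+-comm = solve-∀

∑-*ˡ : ∀ n c (f : ℕ → ℕ) → ∑ n (λ k → c * f k) ≡ c * ∑ n f
∑-*ˡ zero    c f = sym (*-zeroʳ c)
∑-*ˡ (suc n) c f = trans (cong (_+ c * f (suc n)) (∑-*ˡ n c f)) (sym (*-distribˡ-+ c (∑ n f) (f (suc n))))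

∑-*ʳ : ∀ n c (f : ℕ → ℕ) → ∑ n (λ k → f k * c) ≡ ∑ n f * c
∑-*ʳ zero    c f = refl
∑-*ʳ (suc n) c f = trans (cong (_+ f (suc n) * c) (∑-*ʳ n c f)) (sym (*-distribʳ-+ c (∑ n f) (f (suc n))))

∑-comm : ∀ n m (f : ℕ → ℕ → ℕ) → ∑ n (λ i → ∑ m (f i)) ≡ ∑ m (λ j → ∑ n (λ i → f i j))
∑-comm zero    m f = sym (∑-zero m (λ _ _ _ → refl))
∑-comm (suc n) m f = trans (cong (_+ ∑ m (f (suc n))) (∑-comm n m f)) (sym (∑-+ m _ (f (suc n))))

∑-single : ∀ n {f : ℕ → ℕ} K → 1 ≤ K → K ≤ n → (∀ k → 1 ≤ k → k ≤ n → k ≢ K → f k ≡ 0) →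
  ∑ n f ≡ f K
∑-single zero    (suc K) 1≤K () _
∑-single (suc n) {f} K 1≤K K≤1+n others with K ≟ℕ suc n
... | yes refl =
  cong (_+ f (suc n)) (∑-zero n (λ k 1≤k k≤n → others k 1≤k (m≤n⇒m≤1+n k≤n) (<⇒≢ (s≤s k≤n))))
... | no K≢1+n = trans
  (cong₂ _+_ (∑-single n K 1≤K (≤-pred (≤∧≢⇒< K≤1+n K≢1+n)) (λ k 1≤k k≤n → others k 1≤k (m≤n⇒m≤1+n k≤n)))
             (others (suc n) (s≤s z≤n) ≤-refl (K≢1+n ∘ sym)))
  (+-identityʳ _)

∑-⟦≤⟧ : ∀ n A → ∑ n (λ k → ⟦ k ≤ A ⟧) ≡ n ⊓ A
∑-⟦≤⟧ zero    A = refl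
∑-⟦≤⟧ (suc n) A with suc n ≤? A
... | yes 1+n≤A = trans (cong (_+ 1) (trans (∑-⟦≤⟧ n A) (m≤n⇒m⊓n≡m (≤-trans (n≤1+n n) 1+n≤A))))
                        (trans (+-comm n 1) (sym (m≤n⇒m⊓n≡m 1+n≤A)))
... | no 1+n≰A = trans (cong (_+ 0) (trans (∑-⟦≤⟧ n A) (m≥n⇒m⊓n≡n A≤n)))
                       (trans (+-identityʳ A) (sym (m≥n⇒m⊓n≡n (m≤n⇒m≤1+n A≤n))))
  where A≤n = ≤-pred (≰⇒> 1+n≰A)

∑³ : ℕ → (Pt → ℕ) → ℕ
∑³ m F = ∑ m λ a → ∑ m λ b → ∑ m λ c → F (a , b , c)

module _ (m : ℕ) where

  ∑³-cong : {F G : Pt → ℕ} → (∀ w → InC (2 + m) w → F w ≡ G w) → ∑³ m F ≡ ∑³ m G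
  ∑³-cong eq = ∑-cong m λ a a₁ a₂ → ∑-cong m λ b b₁ b₂ → ∑-cong m λ c c₁ c₂ →
    eq (a , b , c) ((a₁ , a₂) , (b₁ , b₂) , (c₁ , c₂))

  ∑³-+ : (F G : Pt → ℕ) → ∑³ m (λ w → F w + G w) ≡ ∑³ m F + ∑³ m G
  ∑³-+ F G = trans (∑-cong m λ a _ _ → trans (∑-cong m λ b _ _ → ∑-+ m _ _) (∑-+ m _ _)) (∑-+ m _ _)

  ∑³-*ˡ : ∀ c (F : Pt → ℕ) → ∑³ m (λ w → c * F w) ≡ c * ∑³ m F
  ∑³-*ˡ c F = trans (∑-cong m λ a _ _ → trans (∑-cong m λ b _ _ → ∑-*ˡ m c _) (∑-*ˡ m c _)) (∑-*ˡ m c _)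

  ∑³-∑ : ∀ n (F : ℕ → Pt → ℕ) → ∑³ m (λ w → ∑ n (λ k → F k w)) ≡ ∑ n (λ k → ∑³ m (F k))
  ∑³-∑ n F = trans (∑-cong m λ a _ _ → trans (∑-cong m λ b _ _ → ∑-comm m n _) (∑-comm m n _)) (∑-comm m n _)

  ∑³-product : (f g h : ℕ → ℕ) → ∑³ m (λ (a , b , c) → f a * g b * h c) ≡ ∑ m f * ∑ m g * ∑ m h
  ∑³-product f g h = begin
    ∑ m (λ a → ∑ m λ b → ∑ m λ c → f a * g b * h c)
      ≡⟨ ∑-cong m (λ a _ _ → ∑-cong m λ b _ _ → ∑-*ˡ m (f a * g b) h) ⟩
    ∑ m (λ a → ∑ m λ b → f a * g b * ∑ m h)
      ≡⟨ ∑-cong m (λ a _ _ → ∑-*ʳ m (∑ m h) (λ b → f a * g b)) ⟩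
    ∑ m (λ a → ∑ m (λ b → f a * g b) * ∑ m h)
      ≡⟨ ∑-*ʳ m (∑ m h) _ ⟩
    ∑ m (λ a → ∑ m (λ b → f a * g b)) * ∑ m h
      ≡⟨ cong (_* ∑ m h) (trans (∑-cong m λ a _ _ → ∑-*ˡ m (f a) g) (∑-*ʳ m (∑ m g) f)) ⟩
    ∑ m f * ∑ m g * ∑ m h
      ∎
    where open ≡-Reasoning

-- κ as a sum over C

length-filter≡sum : ∀ {P : A → Set} (P? : ∀ x → Dec (P x)) (xs : List A) →
  length (filter P? xs) ≡ sum (map (ind ∘ P?) xs)
length-filter≡sum P? []       = refl
length-filter≡sum P? (x ∷ xs) with P? x
... | yes _ = cong suc (length-filter≡sum P? xs)
... | no  _ = length-filter≡sum P? xs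

sum-map-concatMap : (f : B → ℕ) (g : A → List B) (xs : List A) →
  sum (map f (concatMap g xs)) ≡ sum (map (λ x → sum (map f (g x))) xs)
sum-map-concatMap f g []       = refl
sum-map-concatMap f g (x ∷ xs) = begin
  sum (map f (g x ++ concatMap g xs))              ≡⟨ cong sum (map-++ f (g x) (concatMap g xs)) ⟩
  sum (map f (g x) ++ map f (concatMap g xs))      ≡⟨ sum-++ (map f (g x)) _ ⟩
  sum (map f (g x)) + sum (map f (concatMap g xs)) ≡⟨ cong (_+_ (sum (map f (g x)))) (sum-map-concatMap f g xs) ⟩
  sum (map (λ x → sum (map f (g x))) (x ∷ xs))     ∎
  where open ≡-Reasoning

sum-map-inner : ∀ m (f : ℕ → ℕ) → sum (map f (inner (2 + m))) ≡ ∑ m f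
sum-map-inner zero    f = refl
sum-map-inner (suc m) f = begin
  sum (map f (map suc (upTo (suc m))))             ≡⟨ cong (sum ∘ map f ∘ map suc) (sym (applyUpTo-∷ʳ id m)) ⟩
  sum (map f (map suc (upTo m ++ [ m ])))           ≡⟨ cong (sum ∘ map f) (map-++ suc (upTo m) [ m ]) ⟩
  sum (map f (map suc (upTo m) ++ [ suc m ]))       ≡⟨ cong sum (map-++ f (map suc (upTo m)) [ suc m ]) ⟩
  sum (map f (map suc (upTo m)) ++ [ f (suc m) ])   ≡⟨ sum-++ (map f (map suc (upTo m))) [ f (suc m) ] ⟩
  sum (map f (inner (2 + m))) + (f (suc m) + 0)     ≡⟨ cong₂ _+_ (sum-map-inner m f) (+-identityʳ (f (suc m))) ⟩
  ∑ (suc m) f                                       ∎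
  where open ≡-Reasoning

κ≡∑³ : ∀ m q → κ (2 + m) q ≡ ∑³ m (λ w → ind (inClosedNbhd? q w))
κ≡∑³ m q = begin
  length (filter (inClosedNbhd? q) (cubeList (2 + m)))
    ≡⟨ length-filter≡sum (inClosedNbhd? q) (cubeList (2 + m)) ⟩
  sum (map I (cubeList (2 + m)))
    ≡⟨ sum-concatMap-inner (λ a → concatMap (λ b → map (λ c → (a , b , c)) J) J) ⟩
  ∑ m (λ a → sum (map I (concatMap (λ b → map (λ c → (a , b , c)) J) J)))
    ≡⟨ ∑-cong m (λ a _ _ → sum-concatMap-inner (λ b → map (λ c → (a , b , c)) J)) ⟩
  ∑ m (λ a → ∑ m λ b → sum (map I (map (λ c → (a , b , c)) J)))
    ≡⟨ ∑-cong m (λ a _ _ → ∑-cong m λ b _ _ → trans (cong sum (sym (map-∘ J))) (sum-map-inner m _)) ⟩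
  ∑³ m I
    ∎
  where
  open ≡-Reasoning
  I = ind ∘ inClosedNbhd? q
  J = inner (2 + m)
  sum-concatMap-inner : (g : ℕ → List Pt) → sum (map I (concatMap g J)) ≡ ∑ m (λ a → sum (map I (g a)))
  sum-concatMap-inner g = trans (sum-map-concatMap I g J) (sum-map-inner m _)

-- Queen moves as common coordinate offsets

signs : List ℤ
signs = -1ℤ ∷ 0ℤ ∷ 1ℤ ∷ []

SignVector : Vec3 → Set
SignVector (s₁ , s₂ , s₃) = s₁ ∈ signs × s₂ ∈ signs × s₃ ∈ signs

-- Up to sign the 13 directions are exactly the nonzero vectors with entries in {−1, 0, 1};
-- both halves of this are checked by evaluation.
dirs-signVectors : All SignVector dirs
dirs-signVectors =
  toWitness {a? = all? (λ (s₁ , s₂ , s₃) → s₁ ∈? signs ×-dec s₂ ∈? signs ×-dec s₃ ∈? signs) dirs} _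

0⃗ : Vec3
0⃗ = 0ℤ , 0ℤ , 0ℤ

±Dir : Vec3 → Set
±Dir s = Any (λ d → s ≡ 1ℤ · d ⊎ s ≡ -1ℤ · d) dirs

±dir? : ∀ s → Dec (±Dir s)
±dir? s = any? (λ d → (s ≟V (1ℤ · d)) ⊎-dec (s ≟V (-1ℤ · d))) dirs

signVector⇒±dir : ∀ {s} → SignVector s → s ≢ 0⃗ → ±Dir s
signVector⇒±dir {s₁ , s₂ , s₃} (σ₁ , σ₂ , σ₃) = All.lookup (All.lookup (All.lookup table σ₁) σ₂) σ₃
  where
  table : All (λ s₁ → All (λ s₂ → All (λ s₃ → (s₁ , s₂ , s₃) ≢ 0⃗ → ±Dir (s₁ , s₂ , s₃)) signs) signs) signs
  table = toWitness {a? = all? (λ s₁ → all? (λ s₂ → all? (λ s₃ →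
            ¬? ((s₁ , s₂ , s₃) ≟V 0⃗) →-dec ±dir? (s₁ , s₂ , s₃)) signs) signs) signs} _

Offset : ℕ → ℕ → ℕ → Set
Offset k x a = a ≡ x ⊎ a ≡ x + k ⊎ x ≡ a + k

offset? : ∀ k x a → Dec (Offset k x a)
offset? k x a = (a ≟ℕ x) ⊎-dec (a ≟ℕ x + k) ⊎-dec (x ≟ℕ a + k)

module _ {a x : ℕ} where

  diff⇒offset : ∀ z → + a ℤ.- + x ≡ z → Offset ∣ z ∣ x a
  diff⇒offset (+ K) eq =
    inj₂ (inj₁ (trans (ℤ.+-injective (trans (sym (cancel (+ a) (+ x))) (cong (ℤ._+ + x) eq))) (+-comm K x)))
    where cancel : ∀ i j → (i ℤ.- j) ℤ.+ j ≡ i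
          cancel = ℤ-Solver.solve-∀
  diff⇒offset -[1+ K ] eq =
    inj₂ (inj₂ (ℤ.+-injective (trans (sym (cancel (+ a) (+ x))) (cong (λ z → + a ℤ.+ ℤ.- z) eq))))
    where cancel : ∀ i j → i ℤ.+ ℤ.- (i ℤ.- j) ≡ j
          cancel = ℤ-Solver.solve-∀

  sign⇒offset : ∀ {k s} → s ∈ signs → + a ℤ.- + x ≡ k ℤ.* s → Offset ∣ k ∣ x a
  sign⇒offset {k} (here refl) eq =
    subst (λ K → Offset K x a) (ℤ.∣-i∣≡∣i∣ k) (diff⇒offset (ℤ.- k) (trans eq (trans (ℤ.*-comm k -1ℤ) (ℤ.-1*i≡-i k))))
  sign⇒offset {k} (there (here refl)) eq =
    inj₁ (ℤ.+-injective (ℤ.i-j≡0⇒i≡j (+ a) (+ x) (trans eq (ℤ.*-zeroʳ k))))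
  sign⇒offset {k} (there (there (here refl))) eq = diff⇒offset k (trans eq (ℤ.*-identityʳ k))

  offset⇒sign : ∀ {K} → Offset K x a → ∃[ s ] (s ∈ signs × + a ℤ.- + x ≡ + K ℤ.* s)
  offset⇒sign {K} (inj₁ refl) =
    0ℤ , there (here refl) , trans (ℤ.+-inverseʳ (+ x)) (sym (ℤ.*-zeroʳ (+ K)))
  offset⇒sign {K} (inj₂ (inj₁ refl)) =
    1ℤ , there (there (here refl)) , trans (solve (+ x) (+ K)) (sym (ℤ.*-identityʳ (+ K)))
    where solve : ∀ i j → (i ℤ.+ j) ℤ.- i ≡ j
          solve = ℤ-Solver.solve-∀
  offset⇒sign {K} (inj₂ (inj₂ refl)) =
    -1ℤ , here refl , trans (solve (+ a) (+ K)) (sym (trans (ℤ.*-comm (+ K) -1ℤ) (ℤ.-1*i≡-i (+ K))))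
    where solve : ∀ i j → i ℤ.- (i ℤ.+ j) ≡ ℤ.- j
          solve = ℤ-Solver.solve-∀

Offset³ : ℕ → Pt → Pt → Set
Offset³ k (x₁ , x₂ , x₃) (a₁ , a₂ , a₃) = Offset k x₁ a₁ × Offset k x₂ a₂ × Offset k x₃ a₃

adjacent⇒offset³ : ∀ {q w} → Adjacent q w → ∃[ K ] (1 ≤ K × Offset³ K q w)
adjacent⇒offset³ (_ , along) with lookupAny dirs-signVectors along
... | (σ₁ , σ₂ , σ₃) , k , k≢0 , eq =
  ∣ k ∣ , n≢0⇒n>0 (k≢0 ∘ ℤ.∣i∣≡0⇒i≡0) ,
  sign⇒offset {k = k} σ₁ (cong proj₁ eq) ,
  sign⇒offset {k = k} σ₂ (cong (proj₁ ∘ proj₂) eq) ,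
  sign⇒offset {k = k} σ₃ (cong (proj₂ ∘ proj₂) eq)

·-assoc : ∀ k l (d : Vec3) → k · (l · d) ≡ (k ℤ.* l) · d
·-assoc k l (d₁ , d₂ , d₃) =
  sym (cong₂ _,_ (ℤ.*-assoc k l d₁) (cong₂ _,_ (ℤ.*-assoc k l d₂) (ℤ.*-assoc k l d₃)))

offset³⇒adjacent : ∀ {K q w} → 1 ≤ K → Offset³ K q w → q ≢ w → Adjacent q w
offset³⇒adjacent {suc K} {x₁ , x₂ , x₃} {a₁ , a₂ , a₃} _ (o₁ , o₂ , o₃) q≢w
  with offset⇒sign o₁ | offset⇒sign o₂ | offset⇒sign o₃
... | s₁ , σ₁ , e₁ | s₂ , σ₂ , e₂ | s₃ , σ₃ , e₃ =
  q≢w , Any.map multiple (signVector⇒±dir (σ₁ , σ₂ , σ₃) s≢0⃗)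
  where
  w⊖q≡K·s : (a₁ , a₂ , a₃) ⊖ (x₁ , x₂ , x₃) ≡ (+ suc K) · (s₁ , s₂ , s₃)
  w⊖q≡K·s = cong₂ _,_ e₁ (cong₂ _,_ e₂ e₃)
  coincide : ∀ {a x} → + a ℤ.- + x ≡ + suc K ℤ.* 0ℤ → x ≡ a
  coincide {a} {x} eq = sym (ℤ.+-injective (ℤ.i-j≡0⇒i≡j (+ a) (+ x) (trans eq (ℤ.*-zeroʳ (+ suc K)))))
  s≢0⃗ : (s₁ , s₂ , s₃) ≢ 0⃗
  s≢0⃗ refl = q≢w (cong₂ _,_ (coincide e₁) (cong₂ _,_ (coincide e₂) (coincide e₃)))
  multiple : ∀ {d} → (s₁ , s₂ , s₃) ≡ 1ℤ · d ⊎ (s₁ , s₂ , s₃) ≡ -1ℤ · d →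
    NonzeroMultipleOf ((a₁ , a₂ , a₃) ⊖ (x₁ , x₂ , x₃)) d
  multiple {d} (inj₁ s≡d) =
    + suc K ℤ.* 1ℤ , (λ ()) , trans w⊖q≡K·s (trans (cong ((+ suc K) ·_) s≡d) (·-assoc (+ suc K) 1ℤ d))
  multiple {d} (inj₂ s≡-d) =
    + suc K ℤ.* -1ℤ , (λ ()) , trans w⊖q≡K·s (trans (cong ((+ suc K) ·_) s≡-d) (·-assoc (+ suc K) -1ℤ d))

m≡m+n+o⇒n≡o : ∀ m n o → m ≡ m + n + o → n ≡ o
m≡m+n+o⇒n≡o m n o eq = trans (m+n≡0⇒m≡0 n n+o≡0) (sym (m+n≡0⇒n≡0 n n+o≡0))
  where
  n+o≡0 : n + o ≡ 0
  n+o≡0 = sym (+-cancelˡ-≡ m 0 (n + o) (trans (+-identityʳ m) (trans eq (+-assoc m n o))))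

offset-unique : ∀ {k K x a} → a ≢ x → Offset k x a → Offset K x a → k ≡ K
offset-unique a≢x (inj₁ a≡x) _ = ⊥-elim (a≢x a≡x)
offset-unique a≢x (inj₂ _) (inj₁ a≡x) = ⊥-elim (a≢x a≡x)
offset-unique {k} {K} {x} _ (inj₂ (inj₁ e)) (inj₂ (inj₁ f)) = +-cancelˡ-≡ x k K (trans (sym e) f)
offset-unique {k} {K} {a = a} _ (inj₂ (inj₂ e)) (inj₂ (inj₂ f)) = +-cancelˡ-≡ a k K (trans (sym e) f)
offset-unique {k} {K} {x} _ (inj₂ (inj₁ refl)) (inj₂ (inj₂ f)) = m≡m+n+o⇒n≡o x k K f
offset-unique {k} {K} {a = a} _ (inj₂ (inj₂ refl)) (inj₂ (inj₁ f)) = m≡m+n+o⇒n≡o a k K f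

offset-≤ : ∀ {m K x a} → a ≢ x → Offset K x a → 1 ≤ a → a ≤ m → x < 2 + m → K ≤ m
offset-≤ a≢x (inj₁ a≡x) _ _ _ = ⊥-elim (a≢x a≡x)
offset-≤ {K = K} {x} _ (inj₂ (inj₁ refl)) _ a≤m _ = ≤-trans (m≤n+m K x) a≤m
offset-≤ {K = K} {a = a} _ (inj₂ (inj₂ refl)) 1≤a _ (s≤s a+K≤1+m) =
  ≤-pred (≤-trans (+-monoˡ-≤ K 1≤a) a+K≤1+m)

Differ : Pt → Pt → Set
Differ (x₁ , x₂ , x₃) (a₁ , a₂ , a₃) = a₁ ≢ x₁ ⊎ a₂ ≢ x₂ ⊎ a₃ ≢ x₃

≡⊎differ : ∀ q w → w ≡ q ⊎ Differ q w
≡⊎differ (x₁ , x₂ , x₃) (a₁ , a₂ , a₃) with a₁ ≟ℕ x₁ | a₂ ≟ℕ x₂ | a₃ ≟ℕ x₃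
... | yes refl | yes refl | yes refl = inj₁ refl
... | no a₁≢x₁ | _        | _        = inj₂ (inj₁ a₁≢x₁)
... | yes _    | no a₂≢x₂ | _        = inj₂ (inj₂ (inj₁ a₂≢x₂))
... | yes _    | yes _    | no a₃≢x₃ = inj₂ (inj₂ (inj₂ a₃≢x₃))

differ⇒≢ : ∀ {q w} → Differ q w → q ≢ w
differ⇒≢ (inj₁ a₁≢x₁)        refl = a₁≢x₁ refl
differ⇒≢ (inj₂ (inj₁ a₂≢x₂)) refl = a₂≢x₂ refl
differ⇒≢ (inj₂ (inj₂ a₃≢x₃)) refl = a₃≢x₃ refl

offset³-unique : ∀ {k K q w} → Differ q w → Offset³ k q w → Offset³ K q w → k ≡ K
offset³-unique (inj₁ a₁≢x₁)        (o₁ , _ , _) (o₁′ , _ , _) = offset-unique a₁≢x₁ o₁ o₁′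
offset³-unique (inj₂ (inj₁ a₂≢x₂)) (_ , o₂ , _) (_ , o₂′ , _) = offset-unique a₂≢x₂ o₂ o₂′
offset³-unique (inj₂ (inj₂ a₃≢x₃)) (_ , _ , o₃) (_ , _ , o₃′) = offset-unique a₃≢x₃ o₃ o₃′

offset³-≤ : ∀ {m K q w} → Differ q w → Offset³ K q w → InC (2 + m) w → InBoard (2 + m) q → K ≤ m
offset³-≤ (inj₁ a₁≢x₁)        (o₁ , _ , _) ((1≤a₁ , a₁≤m) , _) (x₁<n , _) = offset-≤ a₁≢x₁ o₁ 1≤a₁ a₁≤m x₁<n
offset³-≤ (inj₂ (inj₁ a₂≢x₂)) (_ , o₂ , _) (_ , (1≤a₂ , a₂≤m) , _) (_ , x₂<n , _) = offset-≤ a₂≢x₂ o₂ 1≤a₂ a₂≤m x₂<n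
offset³-≤ (inj₂ (inj₂ a₃≢x₃)) (_ , _ , o₃) (_ , _ , (1≤a₃ , a₃≤m)) (_ , _ , x₃<n) = offset-≤ a₃≢x₃ o₃ 1≤a₃ a₃≤m x₃<n

-- Counting C ∩ N[q] by offset

x≢x+k : ∀ x {k} → 1 ≤ k → x ≢ x + k
x≢x+k x 1≤k = <⇒≢ (m<m+n x 1≤k)

x≢x+k+k : ∀ x {k} → 1 ≤ k → x ≢ x + k + k
x≢x+k+k x {k} 1≤k = <⇒≢ (≤-trans (m<m+n x 1≤k) (m≤m+n (x + k) k))

δ : ℕ → ℕ → ℕ
δ x a = ind (a ≟ℕ x)

hits : ℕ → ℕ → ℕ → ℕ
hits k x a = δ x a + δ (x + k) a + ind (x ≟ℕ a + k)

hits-offset : ∀ {k x a} → 1 ≤ k → Offset k x a → hits k x a ≡ 1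
hits-offset {k} {x} 1≤k (inj₁ refl) =
  cong₂ _+_ (cong₂ _+_ (ind-yes (x ≟ℕ x) refl) (ind-no (x ≟ℕ x + k) (x≢x+k x 1≤k)))
            (ind-no (x ≟ℕ x + k) (x≢x+k x 1≤k))
hits-offset {k} {x} 1≤k (inj₂ (inj₁ refl)) =
  cong₂ _+_ (cong₂ _+_ (ind-no (x + k ≟ℕ x) (≢-sym (x≢x+k x 1≤k))) (ind-yes (x + k ≟ℕ x + k) refl))
            (ind-no (x ≟ℕ x + k + k) (x≢x+k+k x 1≤k))
hits-offset {k} {a = a} 1≤k (inj₂ (inj₂ refl)) =
  cong₂ _+_ (cong₂ _+_ (ind-no (a ≟ℕ a + k) (x≢x+k a 1≤k)) (ind-no (a ≟ℕ a + k + k) (x≢x+k+k a 1≤k)))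
            (ind-yes (a + k ≟ℕ a + k) refl)

hits-¬offset : ∀ {k x a} → ¬ Offset k x a → hits k x a ≡ 0
hits-¬offset {k} {x} {a} ¬o =
  cong₂ _+_ (cong₂ _+_ (ind-no (a ≟ℕ x) (¬o ∘ inj₁)) (ind-no (a ≟ℕ x + k) (¬o ∘ inj₂ ∘ inj₁)))
            (ind-no (x ≟ℕ a + k) (¬o ∘ inj₂ ∘ inj₂))

δ³ : Pt → Pt → ℕ
δ³ (x₁ , x₂ , x₃) (a₁ , a₂ , a₃) = δ x₁ a₁ * δ x₂ a₂ * δ x₃ a₃

hits³ : ℕ → Pt → Pt → ℕ
hits³ k (x₁ , x₂ , x₃) (a₁ , a₂ , a₃) = hits k x₁ a₁ * hits k x₂ a₂ * hits k x₃ a₃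

δ³-refl : ∀ q → δ³ q q ≡ 1
δ³-refl (x₁ , x₂ , x₃) =
  cong₂ _*_ (cong₂ _*_ (ind-yes (x₁ ≟ℕ x₁) refl) (ind-yes (x₂ ≟ℕ x₂) refl)) (ind-yes (x₃ ≟ℕ x₃) refl)

δ³-differ : ∀ {q w} → Differ q w → δ³ q w ≡ 0
δ³-differ {x₁ , x₂ , x₃} {a₁ , a₂ , a₃} (inj₁ a₁≢x₁) =
  cong (λ d → d * δ x₂ a₂ * δ x₃ a₃) (ind-no (a₁ ≟ℕ x₁) a₁≢x₁)
δ³-differ {x₁ , x₂ , x₃} {a₁ , a₂ , a₃} (inj₂ (inj₁ a₂≢x₂)) =
  trans (cong (λ d → δ x₁ a₁ * d * δ x₃ a₃) (ind-no (a₂ ≟ℕ x₂) a₂≢x₂)) (cong (_* δ x₃ a₃) (*-zeroʳ (δ x₁ a₁)))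
δ³-differ {x₁ , x₂ , x₃} {a₁ , a₂ , a₃} (inj₂ (inj₂ a₃≢x₃)) =
  trans (cong (δ x₁ a₁ * δ x₂ a₂ *_) (ind-no (a₃ ≟ℕ x₃) a₃≢x₃)) (*-zeroʳ (δ x₁ a₁ * δ x₂ a₂))

hits³-offset : ∀ {k q w} → 1 ≤ k → Offset³ k q w → hits³ k q w ≡ 1
hits³-offset 1≤k (o₁ , o₂ , o₃) = cong₂ _*_ (cong₂ _*_ (hits-offset 1≤k o₁) (hits-offset 1≤k o₂)) (hits-offset 1≤k o₃)

hits³-¬offset : ∀ {k q w} → ¬ Offset³ k q w → hits³ k q w ≡ 0
hits³-¬offset {k} {x₁ , x₂ , x₃} {a₁ , a₂ , a₃} ¬o
  with offset? k x₁ a₁ | offset? k x₂ a₂ | offset? k x₃ a₃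
... | yes o₁ | yes o₂ | yes o₃ = ⊥-elim (¬o (o₁ , o₂ , o₃))
... | no ¬o₁ | _      | _      = cong (λ h → h * hits k x₂ a₂ * hits k x₃ a₃) (hits-¬offset ¬o₁)
... | yes _  | no ¬o₂ | _      =
  trans (cong (λ h → hits k x₁ a₁ * h * hits k x₃ a₃) (hits-¬offset ¬o₂))
        (cong (_* hits k x₃ a₃) (*-zeroʳ (hits k x₁ a₁)))
... | yes _  | yes _  | no ¬o₃ =
  trans (cong (hits k x₁ a₁ * hits k x₂ a₂ *_) (hits-¬offset ¬o₃)) (*-zeroʳ (hits k x₁ a₁ * hits k x₂ a₂))

∑-hits³-offset : ∀ {m K q w} → InBoard (2 + m) q → InC (2 + m) w → Differ q w → 1 ≤ K → Offset³ K q w →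
  ∑ m (λ k → hits³ k q w) ≡ 1
∑-hits³-offset {m} {K} {q} {w} q∈ w∈ q≠w 1≤K o = trans
  (∑-single m K 1≤K (offset³-≤ {m} {K} {q} {w} q≠w o w∈ q∈)
    (λ k _ _ k≢K → hits³-¬offset {k} {q} {w} (k≢K ∘ λ o′ → offset³-unique {k} {K} {q} {w} q≠w o′ o)))
  (hits³-offset {K} {q} {w} 1≤K o)

adjacency-count : ∀ {m q w} → InBoard (2 + m) q → InC (2 + m) w → Differ q w →
  (N? : Dec (InClosedNbhd q w)) → ind N? ≡ ∑ m (λ k → hits³ k q w)
adjacency-count q∈ w∈ q≠w (yes (inj₁ w≡q)) = ⊥-elim (differ⇒≢ q≠w (sym w≡q))
adjacency-count {m} {q} {w} q∈ w∈ q≠w (yes (inj₂ adj)) =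
  let K , 1≤K , o = adjacent⇒offset³ {q} {w} adj in sym (∑-hits³-offset {m} {K} {q} {w} q∈ w∈ q≠w 1≤K o)
adjacency-count {m} {q} {w} q∈ w∈ q≠w (no ¬N) =
  sym (∑-zero m λ k 1≤k _ → hits³-¬offset {k} {q} {w} λ o →
    ¬N (inj₂ (offset³⇒adjacent {k} {q} {w} 1≤k o (differ⇒≢ q≠w))))

closedNbhd-count-self : ∀ {m} q (N? : Dec (InClosedNbhd q q)) →
  ind N? + m * δ³ q q ≡ δ³ q q + ∑ m (λ k → hits³ k q q)
closedNbhd-count-self {m} q N? = begin
  ind N? + m * δ³ q q               ≡⟨ cong₂ (λ i d → i + m * d) (ind-yes N? (inj₁ refl)) (δ³-refl q) ⟩
  1 + m * 1                         ≡⟨ cong₂ _+_ (sym (δ³-refl q)) (sym (∑-const m 1)) ⟩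
  δ³ q q + ∑ m (λ _ → 1)            ≡⟨ cong (_+_ (δ³ q q)) (∑-cong m λ k 1≤k _ →
                                         sym (hits³-offset {k} {q} {q} 1≤k self)) ⟩
  δ³ q q + ∑ m (λ k → hits³ k q q)  ∎
  where
  open ≡-Reasoning
  self : ∀ {k} → Offset³ k q q
  self = inj₁ refl , inj₁ refl , inj₁ refl

-- q itself is offset from q by every k, whence the correction term m · δ³ q w.
closedNbhd-count : ∀ {m q w} → InBoard (2 + m) q → InC (2 + m) w → (N? : Dec (InClosedNbhd q w)) →
  ind N? + m * δ³ q w ≡ δ³ q w + ∑ m (λ k → hits³ k q w)
closedNbhd-count {m} {q} {w} q∈ w∈ N? with ≡⊎differ q w
... | inj₁ refl = closedNbhd-count-self {m} q N?
... | inj₂ q≠w = begin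
  ind N? + m * δ³ q w               ≡⟨ cong (λ d → ind N? + m * d) (δ³-differ {q} {w} q≠w) ⟩
  ind N? + m * 0                    ≡⟨ trans (cong (_+_ (ind N?)) (*-zeroʳ m)) (+-identityʳ (ind N?)) ⟩
  ind N?                            ≡⟨ adjacency-count {m} {q} {w} q∈ w∈ q≠w N? ⟩
  ∑ m (λ k → hits³ k q w)           ≡⟨ cong (_+ ∑ m (λ k → hits³ k q w)) (sym (δ³-differ {q} {w} q≠w)) ⟩
  δ³ q w + ∑ m (λ k → hits³ k q w)  ∎
  where open ≡-Reasoning

rowCount : ℕ → ℕ → ℕ → ℕ
rowCount m x k = ∑ m (hits k x)

κ-formula : ∀ m x₁ x₂ x₃ → InBoard (2 + m) (x₁ , x₂ , x₃) →
  let E = ∑ m (δ x₁) * ∑ m (δ x₂) * ∑ m (δ x₃) in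
  κ (2 + m) (x₁ , x₂ , x₃) + m * E ≡ E + ∑ m (λ k → rowCount m x₁ k * rowCount m x₂ k * rowCount m x₃ k)
κ-formula m x₁ x₂ x₃ q∈ = begin
  κ (2 + m) q + m * E
    ≡⟨ cong₂ (λ s d → s + m * d) (κ≡∑³ m q) (sym (∑³-product m (δ x₁) (δ x₂) (δ x₃))) ⟩
  ∑³ m N + m * ∑³ m (δ³ q)
    ≡⟨ cong (_+_ (∑³ m N)) (sym (∑³-*ˡ m m (δ³ q))) ⟩
  ∑³ m N + ∑³ m (λ w → m * δ³ q w)
    ≡⟨ sym (∑³-+ m N (λ w → m * δ³ q w)) ⟩
  ∑³ m (λ w → N w + m * δ³ q w)
    ≡⟨ ∑³-cong m (λ w w∈ → closedNbhd-count {m} {q} {w} q∈ w∈ (inClosedNbhd? q w)) ⟩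
  ∑³ m (λ w → δ³ q w + ∑ m (λ k → hits³ k q w))
    ≡⟨ ∑³-+ m (δ³ q) (λ w → ∑ m (λ k → hits³ k q w)) ⟩
  ∑³ m (δ³ q) + ∑³ m (λ w → ∑ m (λ k → hits³ k q w))
    ≡⟨ cong₂ _+_ (∑³-product m (δ x₁) (δ x₂) (δ x₃)) (∑³-∑ m m (λ k w → hits³ k q w)) ⟩
  E + ∑ m (λ k → ∑³ m (hits³ k q))
    ≡⟨ cong (_+_ E) (∑-cong m λ k _ _ → ∑³-product m (hits k x₁) (hits k x₂) (hits k x₃)) ⟩
  E + ∑ m (λ k → rowCount m x₁ k * rowCount m x₂ k * rowCount m x₃ k)
    ∎
  where
  open ≡-Reasoning
  q = (x₁ , x₂ , x₃)
  E = ∑ m (δ x₁) * ∑ m (δ x₂) * ∑ m (δ x₃)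
  N = λ w → ind (inClosedNbhd? q w)

-- Row counts

∑-δ : ∀ m y → 1 ≤ y → ∑ m (δ y) ≡ ⟦ y ≤ m ⟧
∑-δ m y 1≤y with y ≤? m
... | yes y≤m = trans (∑-single m y 1≤y y≤m (λ k _ _ k≢y → ind-no (k ≟ℕ y) k≢y)) (ind-yes (y ≟ℕ y) refl)
... | no  y≰m = ∑-zero m (λ k _ k≤m → ind-no (k ≟ℕ y) (λ { refl → y≰m k≤m }))

∑-δ-0 : ∀ m → ∑ m (δ 0) ≡ 0
∑-δ-0 m = ∑-zero m (λ { k (s≤s _) _ → ind-no (k ≟ℕ 0) (λ ()) })

∑-δ-shift : ∀ m k x → x ≤ m + k → ∑ m (λ a → ind (x ≟ℕ a + k)) ≡ ⟦ suc k ≤ x ⟧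
∑-δ-shift m k x x≤m+k with suc k ≤? x
... | yes k<x = trans
  (∑-single m (x ∸ k) (m+n≤o⇒m≤o∸n 1 k<x) (subst (x ∸ k ≤_) (m+n∸n≡m m k) (∸-monoˡ-≤ k x≤m+k))
    (λ a _ _ a≢x∸k → ind-no (x ≟ℕ a + k) (λ x≡a+k → a≢x∸k (sym (trans (cong (_∸ k) x≡a+k) (m+n∸n≡m a k))))))
  (ind-yes (x ≟ℕ x ∸ k + k) (sym (m∸n+n≡m (<⇒≤ k<x))))
... | no k≮x = ∑-zero m (λ a 1≤a _ → ind-no (x ≟ℕ a + k) (λ { refl → k≮x (+-monoˡ-≤ k 1≤a) }))

rowCount-value : ∀ m x k → 1 ≤ k → x < 2 + m → rowCount m x k ≡ ∑ m (δ x) + ⟦ x + k ≤ m ⟧ + ⟦ suc k ≤ x ⟧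
rowCount-value m x k 1≤k (s≤s x≤1+m) = begin
  ∑ m (λ a → δ x a + δ (x + k) a + ind (x ≟ℕ a + k))
    ≡⟨ ∑-+ m _ _ ⟩
  ∑ m (λ a → δ x a + δ (x + k) a) + ∑ m (λ a → ind (x ≟ℕ a + k))
    ≡⟨ cong₂ _+_ (∑-+ m _ _) (∑-δ-shift m k x x≤m+k) ⟩
  ∑ m (δ x) + ∑ m (δ (x + k)) + ⟦ suc k ≤ x ⟧
    ≡⟨ cong (λ s → ∑ m (δ x) + s + ⟦ suc k ≤ x ⟧) (∑-δ m (x + k) (≤-trans 1≤k (m≤n+m k x))) ⟩
  ∑ m (δ x) + ⟦ x + k ≤ m ⟧ + ⟦ suc k ≤ x ⟧
    ∎
  where
  open ≡-Reasoning
  x≤m+k : x ≤ m + k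
  x≤m+k = ≤-trans x≤1+m (subst (_≤ m + k) (+-comm m 1) (+-monoʳ-≤ m 1≤k))

data Position (m x : ℕ) : Set where
  extreme  : Extreme (2 + m) x → Position m x
  interior : 1 ≤ x → x ≤ m → Position m x

position : ∀ {m x} → x < 2 + m → Position m x
position {m} {zero}  _ = extreme (inj₁ refl)
position {m} {suc x} (s≤s x<1+m) with suc x ≟ℕ suc m
... | yes x≡1+m = extreme (inj₂ x≡1+m)
... | no  x≢1+m = interior (s≤s z≤n) (≤-pred (≤∧≢⇒< x<1+m x≢1+m))

position⇒< : ∀ {m x} → Position m x → x < 2 + m
position⇒< (extreme (inj₁ refl)) = s≤s z≤n
position⇒< (extreme (inj₂ refl)) = ≤-refl
position⇒< (interior _ x≤m) = s≤s (m≤n⇒m≤1+n x≤m)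

isInterior : ∀ {m x} → Position m x → ℕ
isInterior (extreme _)    = 0
isInterior (interior _ _) = 1

isExtreme : ∀ {m x} → Position m x → ℕ
isExtreme (extreme _)    = 1
isExtreme (interior _ _) = 0

-- of the two cells at distance k from a point with A cells of [1, m] above and B below it,
-- the number lying in [1, m]
sides : ℕ → ℕ → ℕ → ℕ
sides A B k = ⟦ k ≤ A ⟧ + ⟦ k ≤ B ⟧

interiorProfile : ℕ → ℕ → ℕ → ℕ
interiorProfile m x k = 1 + sides (m ∸ x) (x ∸ 1) k

profile : ∀ {m x} → Position m x → ℕ → ℕ
profile         (extreme _)    k = 1
profile {m} {x} (interior _ _) k = interiorProfile m x k

∑-δ-position : ∀ {m x} (p : Position m x) → ∑ m (δ x) ≡ isInterior p
∑-δ-position {m} (extreme (inj₁ refl)) = ∑-δ-0 m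
∑-δ-position {m} (extreme (inj₂ refl)) = trans (∑-δ m (suc m) (s≤s z≤n)) (ind-no (suc m ≤? m) (n≮n m))
∑-δ-position {m} {x} (interior 1≤x x≤m) = trans (∑-δ m x 1≤x) (ind-yes (x ≤? m) x≤m)

⟦+≤⟧≡⟦≤∸⟧ : ∀ x k m → x ≤ m → ⟦ x + k ≤ m ⟧ ≡ ⟦ k ≤ m ∸ x ⟧
⟦+≤⟧≡⟦≤∸⟧ x k m x≤m = ind-cong (x + k ≤? m) (k ≤? m ∸ x)
  (λ x+k≤m → m+n≤o⇒m≤o∸n k (subst (_≤ m) (+-comm x k) x+k≤m))
  (λ k≤m∸x → subst (_≤ m) (+-comm k x) (m≤o∸n⇒m+n≤o k x≤m k≤m∸x))

rowCount-position : ∀ {m x k} (p : Position m x) → 1 ≤ k → k ≤ m → rowCount m x k ≡ profile p k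
rowCount-position {m} {x} {k} p 1≤k k≤m = trans (rowCount-value m x k 1≤k (position⇒< p)) (evaluate p)
  where
  evaluate : (p : Position m x) → ∑ m (δ x) + ⟦ x + k ≤ m ⟧ + ⟦ suc k ≤ x ⟧ ≡ profile p k
  evaluate (extreme (inj₁ refl)) =
    cong₂ _+_ (cong₂ _+_ (∑-δ-0 m) (ind-yes (k ≤? m) k≤m)) (ind-no (suc k ≤? 0) λ ())
  evaluate (extreme (inj₂ refl)) =
    cong₂ _+_ (cong₂ _+_ (∑-δ-position {m} (extreme (inj₂ refl)))
                         (ind-no (suc m + k ≤? m) (λ 1+m+k≤m → n≮n m (≤-trans (m≤m+n (suc m) k) 1+m+k≤m))))
              (ind-yes (suc k ≤? suc m) (s≤s k≤m))
  evaluate (interior 1≤x x≤m) =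
    cong₂ _+_ (cong₂ _+_ (∑-δ-position {m} (interior 1≤x x≤m)) (⟦+≤⟧≡⟦≤∸⟧ x k m x≤m)) (⟦+≤⟧≡⟦≤∸⟧ 1 k x 1≤x)

κ-positions : ∀ {m x₁ x₂ x₃} (p₁ : Position m x₁) (p₂ : Position m x₂) (p₃ : Position m x₃) →
  let I = isInterior p₁ * isInterior p₂ * isInterior p₃ in
  κ (2 + m) (x₁ , x₂ , x₃) + m * I ≡ I + ∑ m (λ k → profile p₁ k * profile p₂ k * profile p₃ k)
κ-positions {m} {x₁} {x₂} {x₃} p₁ p₂ p₃ = begin
  κ (2 + m) q + m * I  ≡⟨ cong (λ e → κ (2 + m) q + m * e) (sym E≡I) ⟩
  κ (2 + m) q + m * E  ≡⟨ κ-formula m x₁ x₂ x₃ (position⇒< p₁ , position⇒< p₂ , position⇒< p₃) ⟩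
  E + ∑ m (λ k → rowCount m x₁ k * rowCount m x₂ k * rowCount m x₃ k)
    ≡⟨ cong₂ _+_ E≡I (∑-cong m λ k 1≤k k≤m → cong₂ _*_ (cong₂ _*_ (rowCount-position p₁ 1≤k k≤m)
                                                                (rowCount-position p₂ 1≤k k≤m))
                                                      (rowCount-position p₃ 1≤k k≤m)) ⟩
  I + ∑ m (λ k → profile p₁ k * profile p₂ k * profile p₃ k) ∎
  where
  open ≡-Reasoning
  q = (x₁ , x₂ , x₃)
  I = isInterior p₁ * isInterior p₂ * isInterior p₃
  E = ∑ m (δ x₁) * ∑ m (δ x₂) * ∑ m (δ x₃)
  E≡I : E ≡ I
  E≡I = cong₂ _*_ (cong₂ _*_ (∑-δ-position p₁) (∑-δ-position p₂)) (∑-δ-position p₃)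

κ-off-C : ∀ {m x₁ x₂ x₃} (p₁ : Position m x₁) (p₂ : Position m x₂) (p₃ : Position m x₃) →
  isInterior p₁ * isInterior p₂ * isInterior p₃ ≡ 0 →
  κ (2 + m) (x₁ , x₂ , x₃) ≡ ∑ m (λ k → profile p₁ k * profile p₂ k * profile p₃ k)
κ-off-C {m} {x₁} {x₂} {x₃} p₁ p₂ p₃ I≡0 = begin
  κ (2 + m) q          ≡⟨ sym (+-identityʳ (κ (2 + m) q)) ⟩
  κ (2 + m) q + 0      ≡⟨ cong (_+_ (κ (2 + m) q)) (sym (*-zeroʳ m)) ⟩
  κ (2 + m) q + m * 0  ≡⟨ cong (λ i → κ (2 + m) q + m * i) (sym I≡0) ⟩
  κ (2 + m) q + m * I  ≡⟨ κ-positions p₁ p₂ p₃ ⟩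
  I + ∑ m Π            ≡⟨ cong (_+ ∑ m Π) I≡0 ⟩
  ∑ m Π                ∎
  where
  open ≡-Reasoning
  q = (x₁ , x₂ , x₃)
  I = isInterior p₁ * isInterior p₂ * isInterior p₃
  Π = λ k → profile p₁ k * profile p₂ k * profile p₃ k

-- One-dimensional sums

sides≤2 : ∀ A B k → sides A B k ≤ 2
sides≤2 A B k = +-mono-≤ (⟦≤⟧≤1 k A) (⟦≤⟧≤1 k B)

∑-sides : ∀ m A B → A ≤ m → B ≤ m → ∑ m (sides A B) ≡ A + B
∑-sides m A B A≤m B≤m =
  trans (∑-+ m _ _) (cong₂ _+_ (trans (∑-⟦≤⟧ m A) (m≥n⇒m⊓n≡n A≤m)) (trans (∑-⟦≤⟧ m B) (m≥n⇒m⊓n≡n B≤m)))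

∑-1+ : ∀ m (f : ℕ → ℕ) → ∑ m (λ k → 1 + f k) ≡ m + ∑ m f
∑-1+ m f = trans (∑-+ m (λ _ → 1) f) (cong (_+ ∑ m f) (trans (∑-const m 1) (*-identityʳ m)))

∑-1+sides : ∀ m A B → A ≤ m → B ≤ m → ∑ m (λ k → 1 + sides A B k) ≡ m + (A + B)
∑-1+sides m A B A≤m B≤m = trans (∑-1+ m (sides A B)) (cong (_+_ m) (∑-sides m A B A≤m B≤m))

1+sides-*-1+sides : ∀ A₁ B₁ A₂ B₂ k →
  (1 + sides A₁ B₁ k) * (1 + sides A₂ B₂ k)
  ≡ 1 + sides A₁ B₁ k + sides A₂ B₂ k + sides (A₁ ⊓ A₂) (B₁ ⊓ B₂) k + sides (A₁ ⊓ B₂) (B₁ ⊓ A₂) k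
1+sides-*-1+sides A₁ B₁ A₂ B₂ k = trans (expand ⟦ k ≤ A₁ ⟧ ⟦ k ≤ B₁ ⟧ ⟦ k ≤ A₂ ⟧ ⟦ k ≤ B₂ ⟧)
  (cong₂ _+_ (cong (_+_ (1 + sides A₁ B₁ k + sides A₂ B₂ k)) (cong₂ _+_ (⟦≤⟧-*-⊓ k A₁ A₂) (⟦≤⟧-*-⊓ k B₁ B₂)))
             (cong₂ _+_ (⟦≤⟧-*-⊓ k A₁ B₂) (⟦≤⟧-*-⊓ k B₁ A₂)))
  where
  expand : ∀ a₁ b₁ a₂ b₂ → (1 + (a₁ + b₁)) * (1 + (a₂ + b₂))
                          ≡ 1 + (a₁ + b₁) + (a₂ + b₂) + (a₁ * a₂ + b₁ * b₂) + (a₁ * b₂ + b₁ * a₂)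
  expand = solve-∀

∑-face : ∀ m A₁ B₁ A₂ B₂ → A₁ ≤ m → B₁ ≤ m → A₂ ≤ m → B₂ ≤ m →
  ∑ m (λ k → (1 + sides A₁ B₁ k) * (1 + sides A₂ B₂ k))
  ≡ m + (A₁ + B₁) + (A₂ + B₂) + (A₁ ⊓ A₂ + B₁ ⊓ B₂) + (A₁ ⊓ B₂ + B₁ ⊓ A₂)
∑-face m A₁ B₁ A₂ B₂ A₁≤m B₁≤m A₂≤m B₂≤m = begin
  ∑ m (λ k → (1 + sides A₁ B₁ k) * (1 + sides A₂ B₂ k))   ≡⟨ ∑-cong m (λ k _ _ → 1+sides-*-1+sides A₁ B₁ A₂ B₂ k) ⟩
  ∑ m (λ k → 1 + s₁ k + s₂ k + s₃ k + s₄ k)               ≡⟨ ∑-+ m _ s₄ ⟩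
  ∑ m (λ k → 1 + s₁ k + s₂ k + s₃ k) + ∑ m s₄             ≡⟨ cong (_+ ∑ m s₄) (∑-+ m _ s₃) ⟩
  ∑ m (λ k → 1 + s₁ k + s₂ k) + ∑ m s₃ + ∑ m s₄           ≡⟨ cong (λ s → s + ∑ m s₃ + ∑ m s₄) (∑-+ m _ s₂) ⟩
  ∑ m (λ k → 1 + s₁ k) + ∑ m s₂ + ∑ m s₃ + ∑ m s₄         ≡⟨ cong (λ s → s + ∑ m s₂ + ∑ m s₃ + ∑ m s₄) (∑-1+ m s₁) ⟩
  m + ∑ m s₁ + ∑ m s₂ + ∑ m s₃ + ∑ m s₄
    ≡⟨ cong₂ _+_ (cong₂ _+_ (cong₂ _+_ (cong (_+_ m) (∑-sides m A₁ B₁ A₁≤m B₁≤m)) (∑-sides m A₂ B₂ A₂≤m B₂≤m))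
                            (∑-sides m _ _ (≤-trans (m⊓n≤m A₁ A₂) A₁≤m) (≤-trans (m⊓n≤m B₁ B₂) B₁≤m)))
                 (∑-sides m _ _ (≤-trans (m⊓n≤m A₁ B₂) A₁≤m) (≤-trans (m⊓n≤m B₁ A₂) B₁≤m)) ⟩
  m + (A₁ + B₁) + (A₂ + B₂) + (A₁ ⊓ A₂ + B₁ ⊓ B₂) + (A₁ ⊓ B₂ + B₁ ⊓ A₂) ∎
  where
  open ≡-Reasoning
  s₁ = sides A₁ B₁
  s₂ = sides A₂ B₂
  s₃ = sides (A₁ ⊓ A₂) (B₁ ⊓ B₂)
  s₄ = sides (A₁ ⊓ B₂) (B₁ ⊓ A₂)

⊓-pairing-≤ : ∀ {A₁ B₁ A₂ B₂ M} → A₁ ≤ A₂ → A₁ + B₁ ≡ M → A₂ + B₂ ≡ M →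
  A₁ ⊓ A₂ + B₁ ⊓ B₂ + ∣ A₁ - A₂ ∣ ≡ M
⊓-pairing-≤ {A₁} {B₁} {A₂} {B₂} A₁≤A₂ refl A₂+B₂≡M = begin
  A₁ ⊓ A₂ + B₁ ⊓ B₂ + ∣ A₁ - A₂ ∣  ≡⟨ cong₂ _+_ (cong₂ _+_ (m≤n⇒m⊓n≡m A₁≤A₂) (m≥n⇒m⊓n≡n B₂≤B₁))
                                               (trans (∣-∣-comm A₁ A₂) (m≤n⇒∣n-m∣≡n∸m A₁≤A₂)) ⟩
  A₁ + B₂ + (A₂ ∸ A₁)              ≡⟨ rearrange A₁ B₂ (A₂ ∸ A₁) ⟩
  A₁ + (A₂ ∸ A₁) + B₂              ≡⟨ cong (_+ B₂) (m+[n∸m]≡n A₁≤A₂) ⟩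
  A₂ + B₂                          ≡⟨ A₂+B₂≡M ⟩
  A₁ + B₁                          ∎
  where
  open ≡-Reasoning
  B₂≤B₁ : B₂ ≤ B₁
  B₂≤B₁ = +-cancelˡ-≤ A₁ B₂ B₁ (≤-trans (+-monoˡ-≤ B₂ A₁≤A₂) (≤-reflexive A₂+B₂≡M))
  rearrange : ∀ a b c → a + b + c ≡ a + c + b
  rearrange = solve-∀

-- The defect from the trivial bound M records whether the two splittings of M coincide.
⊓-pairing : ∀ A₁ B₁ A₂ B₂ {M} → A₁ + B₁ ≡ M → A₂ + B₂ ≡ M → A₁ ⊓ A₂ + B₁ ⊓ B₂ + ∣ A₁ - A₂ ∣ ≡ M
⊓-pairing A₁ B₁ A₂ B₂ e₁ e₂ with ≤-total A₁ A₂
... | inj₁ A₁≤A₂ = ⊓-pairing-≤ A₁≤A₂ e₁ e₂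
... | inj₂ A₂≤A₁ =
  trans (cong₂ _+_ (cong₂ _+_ (⊓-comm A₁ A₂) (⊓-comm B₁ B₂)) (∣-∣-comm A₁ A₂)) (⊓-pairing-≤ A₂≤A₁ e₂ e₁)

parity≤distances : ∀ A₁ B₁ A₂ B₂ {M} → A₁ + B₁ ≡ M → A₂ + B₂ ≡ M → M % 2 ≤ ∣ A₁ - A₂ ∣ + ∣ A₁ - B₂ ∣
parity≤distances A₁ B₁ A₂ B₂ {M} e₁ e₂ with ∣ A₁ - A₂ ∣ + ∣ A₁ - B₂ ∣ in d≡
... | suc _ = ≤-trans (≤-pred (m%n<n M 2)) (s≤s z≤n)
... | zero  = ≤-reflexive (trans (cong (_% 2) M≡A₁*2) (m*n%n≡0 A₁ 2))
  where
  A₁≡A₂ : A₁ ≡ A₂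
  A₁≡A₂ = ∣m-n∣≡0⇒m≡n (m+n≡0⇒m≡0 ∣ A₁ - A₂ ∣ d≡)
  A₁≡B₂ : A₁ ≡ B₂
  A₁≡B₂ = ∣m-n∣≡0⇒m≡n (m+n≡0⇒n≡0 ∣ A₁ - A₂ ∣ d≡)
  M≡A₁*2 : M ≡ A₁ * 2
  M≡A₁*2 = begin
    M       ≡⟨ sym e₂ ⟩
    A₂ + B₂ ≡⟨ cong₂ _+_ (sym A₁≡A₂) (sym A₁≡B₂) ⟩
    A₁ + A₁ ≡⟨ double A₁ ⟩
    A₁ * 2  ∎
    where
    open ≡-Reasoning
    double : ∀ a → a + a ≡ a * 2
    double = solve-∀

face-⊓-bound : ∀ A₁ B₁ A₂ B₂ {M} → A₁ + B₁ ≡ M → A₂ + B₂ ≡ M →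
  (A₁ ⊓ A₂ + B₁ ⊓ B₂) + (A₁ ⊓ B₂ + B₁ ⊓ A₂) + M % 2 ≤ M + M
face-⊓-bound A₁ B₁ A₂ B₂ {M} e₁ e₂ = begin
  S₁ + S₂ + M % 2        ≤⟨ +-monoʳ-≤ (S₁ + S₂) (parity≤distances A₁ B₁ A₂ B₂ e₁ e₂) ⟩
  S₁ + S₂ + (d₁ + d₂)    ≡⟨ +-+-comm S₁ S₂ d₁ d₂ ⟩
  (S₁ + d₁) + (S₂ + d₂)  ≡⟨ cong₂ _+_ (⊓-pairing A₁ B₁ A₂ B₂ e₁ e₂)
                                      (⊓-pairing A₁ B₁ B₂ A₂ e₁ (trans (+-comm B₂ A₂) e₂)) ⟩
  M + M                  ∎
  where
  open ≤-Reasoning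
  S₁ = A₁ ⊓ A₂ + B₁ ⊓ B₂
  S₂ = A₁ ⊓ B₂ + B₁ ⊓ A₂
  d₁ = ∣ A₁ - A₂ ∣
  d₂ = ∣ A₁ - B₂ ∣
  +-+-comm : ∀ a b c d → a + b + (c + d) ≡ (a + c) + (b + d)
  +-+-comm = solve-∀

∑-face-bound : ∀ M A₁ B₁ A₂ B₂ → A₁ + B₁ ≡ M → A₂ + B₂ ≡ M →
  ∑ (suc M) (λ k → (1 + sides A₁ B₁ k) * (1 + sides A₂ B₂ k)) + M % 2 + 4 ≤ 5 * suc M
∑-face-bound M A₁ B₁ A₂ B₂ e₁ e₂ = begin
  ∑ (suc M) (λ k → (1 + sides A₁ B₁ k) * (1 + sides A₂ B₂ k)) + M % 2 + 4
    ≡⟨ cong (λ s → s + M % 2 + 4) (∑-face (suc M) A₁ B₁ A₂ B₂ (≤A e₁) (≤B e₁) (≤A e₂) (≤B e₂)) ⟩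
  suc M + (A₁ + B₁) + (A₂ + B₂) + S₁ + S₂ + M % 2 + 4
    ≡⟨ cong (λ s → s + S₁ + S₂ + M % 2 + 4) (cong₂ _+_ (cong (_+_ (suc M)) e₁) e₂) ⟩
  suc M + M + M + S₁ + S₂ + M % 2 + 4   ≡⟨ regroup (suc M) M S₁ S₂ (M % 2) ⟩
  suc M + M + M + 4 + (S₁ + S₂ + M % 2) ≤⟨ +-monoʳ-≤ (suc M + M + M + 4) (face-⊓-bound A₁ B₁ A₂ B₂ e₁ e₂) ⟩
  suc M + M + M + 4 + (M + M)           ≡⟨ five M ⟩
  5 * suc M                             ∎
  where
  open ≤-Reasoning
  S₁ = A₁ ⊓ A₂ + B₁ ⊓ B₂
  S₂ = A₁ ⊓ B₂ + B₁ ⊓ A₂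
  ≤A : ∀ {A B} → A + B ≡ M → A ≤ suc M
  ≤A {A} {B} refl = m≤n⇒m≤1+n (m≤m+n A B)
  ≤B : ∀ {A B} → A + B ≡ M → B ≤ suc M
  ≤B {A} {B} refl = m≤n⇒m≤1+n (m≤n+m B A)
  regroup : ∀ m M S₁ S₂ ε → m + M + M + S₁ + S₂ + ε + 4 ≡ m + M + M + 4 + (S₁ + S₂ + ε)
  regroup = solve-∀
  five : ∀ M → suc M + M + M + 4 + (M + M) ≡ 5 * suc M
  five = solve-∀

-- Checked at all 27 points; the weights 5 + 4 + 4 = 13 are forced by the equality at (2, 2, 2).
cube≤affine : ∀ {a} → a < 3 → ∀ {b} → b < 3 → ∀ {c} → c < 3 → (1 + a) * (1 + b) * (1 + c) ≤ 1 + 5 * a + 4 * b + 4 * c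
cube≤affine = toWitness {a? = allUpTo? (λ a → allUpTo? (λ b → allUpTo? (λ c →
  (1 + a) * (1 + b) * (1 + c) ≤? 1 + 5 * a + 4 * b + 4 * c) 3) 3) 3} _

∑-*sides : ∀ m c A B → A ≤ m → B ≤ m → ∑ m (λ k → c * sides A B k) ≡ c * (A + B)
∑-*sides m c A B A≤m B≤m = trans (∑-*ˡ m c (sides A B)) (cong (c *_) (∑-sides m A B A≤m B≤m))

∑-cube-bound : ∀ m A₁ B₁ A₂ B₂ A₃ B₃ → A₁ ≤ m → B₁ ≤ m → A₂ ≤ m → B₂ ≤ m → A₃ ≤ m → B₃ ≤ m →
  ∑ m (λ k → (1 + sides A₁ B₁ k) * (1 + sides A₂ B₂ k) * (1 + sides A₃ B₃ k))
  ≤ m + 5 * (A₁ + B₁) + 4 * (A₂ + B₂) + 4 * (A₃ + B₃)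
∑-cube-bound m A₁ B₁ A₂ B₂ A₃ B₃ A₁≤m B₁≤m A₂≤m B₂≤m A₃≤m B₃≤m = begin
  ∑ m (λ k → (1 + s₁ k) * (1 + s₂ k) * (1 + s₃ k))
    ≤⟨ ∑-mono-≤ m (λ k _ _ → cube≤affine (s≤s (sides≤2 A₁ B₁ k)) (s≤s (sides≤2 A₂ B₂ k)) (s≤s (sides≤2 A₃ B₃ k))) ⟩
  ∑ m (λ k → 1 + 5 * s₁ k + 4 * s₂ k + 4 * s₃ k)
    ≡⟨ trans (∑-+ m _ _) (cong (_+ ∑ m (λ k → 4 * s₃ k))
         (trans (∑-+ m _ _) (cong (_+ ∑ m (λ k → 4 * s₂ k)) (∑-1+ m _)))) ⟩
  m + ∑ m (λ k → 5 * s₁ k) + ∑ m (λ k → 4 * s₂ k) + ∑ m (λ k → 4 * s₃ k)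
    ≡⟨ cong₂ _+_ (cong₂ _+_ (cong (_+_ m) (∑-*sides m 5 A₁ B₁ A₁≤m B₁≤m)) (∑-*sides m 4 A₂ B₂ A₂≤m B₂≤m))
                 (∑-*sides m 4 A₃ B₃ A₃≤m B₃≤m) ⟩
  m + 5 * (A₁ + B₁) + 4 * (A₂ + B₂) + 4 * (A₃ + B₃) ∎
  where
  open ≤-Reasoning
  s₁ = sides A₁ B₁
  s₂ = sides A₂ B₂
  s₃ = sides A₃ B₃

-- On a bit every function is affine.
∑-threshold : ∀ m t (f : ℕ → ℕ) → t ≤ m → f 0 ≤ f 1 → ∑ m (λ k → f ⟦ k ≤ t ⟧) ≡ m * f 0 + (f 1 ∸ f 0) * t
∑-threshold m t f t≤m f0≤f1 = begin
  ∑ m (λ k → f ⟦ k ≤ t ⟧)                        ≡⟨ ∑-cong m (λ k _ _ → affine k) ⟩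
  ∑ m (λ k → f 0 + (f 1 ∸ f 0) * ⟦ k ≤ t ⟧)       ≡⟨ ∑-+ m _ _ ⟩
  ∑ m (λ _ → f 0) + ∑ m (λ k → (f 1 ∸ f 0) * ⟦ k ≤ t ⟧)
    ≡⟨ cong₂ _+_ (∑-const m (f 0))
                 (trans (∑-*ˡ m (f 1 ∸ f 0) _) (cong ((f 1 ∸ f 0) *_) (trans (∑-⟦≤⟧ m t) (m≥n⇒m⊓n≡n t≤m)))) ⟩
  m * f 0 + (f 1 ∸ f 0) * t                      ∎
  where
  open ≡-Reasoning
  affine : ∀ k → f ⟦ k ≤ t ⟧ ≡ f 0 + (f 1 ∸ f 0) * ⟦ k ≤ t ⟧
  affine k with k ≤? t
  ... | yes _ = sym (trans (cong (_+_ (f 0)) (*-identityʳ (f 1 ∸ f 0))) (m+[n∸m]≡n f0≤f1))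
  ... | no  _ = sym (trans (cong (_+_ (f 0)) (*-zeroʳ (f 1 ∸ f 0))) (+-identityʳ (f 0)))

-- Corners, edges, faces and points of C

interior-split : ∀ {m x} → 1 ≤ x → x ≤ m → (m ∸ x) + (x ∸ 1) ≡ m ∸ 1
interior-split {suc m} {suc x} _ (s≤s x≤m) = m∸n+n≡m x≤m

interior⇒¬extreme : ∀ {m x} → 1 ≤ x → x ≤ m → ¬ Extreme (2 + m) x
interior⇒¬extreme (s≤s _) _   (inj₁ ())
interior⇒¬extreme _       x≤m (inj₂ refl) = n≮n _ x≤m

ind-extreme? : ∀ {m x} (p : Position m x) → ind (extreme? (2 + m) x) ≡ isExtreme p
ind-extreme? {m} {x} (extreme e)        = ind-yes (extreme? (2 + m) x) e
ind-extreme? {m} {x} (interior 1≤x x≤m) = ind-no (extreme? (2 + m) x) (interior⇒¬extreme 1≤x x≤m)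

numExtreme-positions : ∀ {m x₁ x₂ x₃} (p₁ : Position m x₁) (p₂ : Position m x₂) (p₃ : Position m x₃) →
  numExtreme (2 + m) (x₁ , x₂ , x₃) ≡ isExtreme p₁ + isExtreme p₂ + isExtreme p₃
numExtreme-positions p₁ p₂ p₃ = cong₂ _+_ (cong₂ _+_ (ind-extreme? p₁) (ind-extreme? p₂)) (ind-extreme? p₃)

κ-corner : ∀ m q → Corner (2 + m) q → κ (2 + m) q ≡ m
κ-corner m (x₁ , x₂ , x₃) (e₁ , e₂ , e₃) =
  trans (κ-off-C (extreme e₁) (extreme e₂) (extreme e₃) refl) (trans (∑-const m 1) (*-identityʳ m))

∑-edge-profile : ∀ {m x} → 1 ≤ x → x ≤ m → ∑ m (interiorProfile m x) ≡ 2 * m ∸ 1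
∑-edge-profile {zero}  (s≤s _) ()
∑-edge-profile {suc M} {x} 1≤x x≤m = begin
  ∑ (suc M) (λ k → 1 + sides (suc M ∸ x) (x ∸ 1) k)
    ≡⟨ ∑-1+sides (suc M) _ _ (m∸n≤m (suc M) x) (≤-trans (m∸n≤m x 1) x≤m) ⟩
  suc M + ((suc M ∸ x) + (x ∸ 1))
    ≡⟨ cong (_+_ (suc M)) (interior-split 1≤x x≤m) ⟩
  suc M + M
    ≡⟨ double M ⟩
  2 * suc M ∸ 1
    ∎
  where
  open ≡-Reasoning
  double : ∀ M → suc M + M ≡ M + (suc M + 0)
  double = solve-∀

κ-edge-positions : ∀ {m x₁ x₂ x₃} (p₁ : Position m x₁) (p₂ : Position m x₂) (p₃ : Position m x₃) →
  isExtreme p₁ + isExtreme p₂ + isExtreme p₃ ≡ 2 → κ (2 + m) (x₁ , x₂ , x₃) ≡ 2 * m ∸ 1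
κ-edge-positions {m} p₁@(extreme _) p₂@(extreme _) p₃@(interior 1≤x x≤m) _ =
  trans (κ-off-C p₁ p₂ p₃ refl)
        (trans (∑-cong m λ k _ _ → *-identityˡ _) (∑-edge-profile 1≤x x≤m))
κ-edge-positions {m} p₁@(extreme _) p₂@(interior 1≤x x≤m) p₃@(extreme _) _ =
  trans (κ-off-C p₁ p₂ p₃ refl)
        (trans (∑-cong m λ k _ _ → trans (*-identityʳ _) (*-identityˡ _)) (∑-edge-profile 1≤x x≤m))
κ-edge-positions {m} p₁@(interior 1≤x x≤m) p₂@(extreme _) p₃@(extreme _) _ =
  trans (κ-off-C p₁ p₂ p₃ refl)
        (trans (∑-cong m λ k _ _ → trans (*-identityʳ _) (*-identityʳ _)) (∑-edge-profile 1≤x x≤m))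
κ-edge-positions (extreme _)    (extreme _)    (extreme _)    ()
κ-edge-positions (extreme _)    (interior _ _) (interior _ _) ()
κ-edge-positions (interior _ _) (extreme _)    (interior _ _) ()
κ-edge-positions (interior _ _) (interior _ _) (extreme _)    ()
κ-edge-positions (interior _ _) (interior _ _) (interior _ _) ()

κ-edge : ∀ m q → InBoard (2 + m) q → numExtreme (2 + m) q ≡ 2 → κ (2 + m) q ≡ 2 * m ∸ 1
κ-edge m (x₁ , x₂ , x₃) (x₁< , x₂< , x₃<) two =
  κ-edge-positions p₁ p₂ p₃ (trans (sym (numExtreme-positions p₁ p₂ p₃)) two)
  where
  p₁ = position x₁<
  p₂ = position x₂<
  p₃ = position x₃<

face-bound : ∀ {m x y} → 1 ≤ x → x ≤ m → 1 ≤ y → y ≤ m →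
  ∑ m (λ k → interiorProfile m x k * interiorProfile m y k) ≤ 5 * m ∸ 4 ∸ (m ∸ 1) % 2
face-bound {zero}  (s≤s _) ()
face-bound {suc M} {x} {y} 1≤x x≤m 1≤y y≤m =
  m+n≤o⇒m≤o∸n _ (m+n≤o⇒m≤o∸n _ (∑-face-bound M _ _ _ _ (interior-split 1≤x x≤m) (interior-split 1≤y y≤m)))

half : ∀ {m c} → 2 * c ≡ suc m → ∃[ t ] (c ≡ suc t × m ≡ suc (t + t))
half {m} {suc t} 2c≡1+m = t , refl , sym (trans (double t) (suc-injective 2c≡1+m))
  where
  double : ∀ t → suc (t + t) ≡ t + suc (t + 0)
  double = solve-∀

interiorProfile-centre : ∀ t k → interiorProfile (suc (t + t)) (suc t) k ≡ 1 + (⟦ k ≤ t ⟧ + ⟦ k ≤ t ⟧)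
interiorProfile-centre t k = cong (λ A → 1 + sides A t k) (m+n∸m≡n t t)

lattice-centre⇔odd : ∀ m → (∃[ c ] 2 * c ≡ suc m) ⇔ (m % 2 ≡ 1)
lattice-centre⇔odd m = mk⇔ to from
  where
  to : ∃[ c ] 2 * c ≡ suc m → m % 2 ≡ 1
  to (c , 2c≡1+m) with half {m} {c} 2c≡1+m
  ... | t , _ , refl = trans (cong (_% 2) (odd t)) ([m+kn]%n≡m%n 1 t 2)
    where
    odd : ∀ t → suc (t + t) ≡ 1 + t * 2
    odd = solve-∀
  from : m % 2 ≡ 1 → ∃[ c ] 2 * c ≡ suc m
  from m%2≡1 =
    suc (m / 2) , trans (double (m / 2)) (cong suc (sym (trans (m≡m%n+[m/n]*n m 2) (cong (_+ m / 2 * 2) m%2≡1))))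
    where
    double : ∀ h → 2 * suc h ≡ suc (1 + h * 2)
    double = solve-∀

-- Whichever coordinate is extreme, κ is the sum over the product of the two interior profiles;
-- Q carries per-coordinate hypotheses over to them.
κ-face-via : ∀ {m x₁ x₂ x₃} (Q R : ℕ → Set) (p₁ : Position m x₁) (p₂ : Position m x₂) (p₃ : Position m x₃) →
  isExtreme p₁ + isExtreme p₂ + isExtreme p₃ ≡ 1 → Q x₁ → Q x₂ → Q x₃ →
  (∀ {x y} → 1 ≤ x → x ≤ m → Q x → 1 ≤ y → y ≤ m → Q y →
     R (∑ m (λ k → interiorProfile m x k * interiorProfile m y k))) →
  R (κ (2 + m) (x₁ , x₂ , x₃))
κ-face-via {m} {x₁} {x₂} {x₃} Q R p₁@(extreme _) p₂@(interior 1≤x x≤m) p₃@(interior 1≤y y≤m) _ _ q₂ q₃ r =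
  subst R (sym (trans (κ-off-C p₁ p₂ p₃ refl) (∑-cong m λ k _ _ →
    cong (_* interiorProfile m x₃ k) (*-identityˡ (interiorProfile m x₂ k)))))
  (r 1≤x x≤m q₂ 1≤y y≤m q₃)
κ-face-via {m} {x₁} {x₂} {x₃} Q R p₁@(interior 1≤x x≤m) p₂@(extreme _) p₃@(interior 1≤y y≤m) _ q₁ _ q₃ r =
  subst R (sym (trans (κ-off-C p₁ p₂ p₃ refl) (∑-cong m λ k _ _ →
    cong (_* interiorProfile m x₃ k) (*-identityʳ (interiorProfile m x₁ k)))))
  (r 1≤x x≤m q₁ 1≤y y≤m q₃)
κ-face-via {m} {x₁} {x₂} {x₃} Q R p₁@(interior 1≤x x≤m) p₂@(interior 1≤y y≤m) p₃@(extreme _) _ q₁ q₂ _ r =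
  subst R (sym (trans (κ-off-C p₁ p₂ p₃ refl) (∑-cong m λ k _ _ →
    *-identityʳ (interiorProfile m x₁ k * interiorProfile m x₂ k))))
  (r 1≤x x≤m q₁ 1≤y y≤m q₂)
κ-face-via _ _ (extreme _)    (extreme _)    (extreme _)    ()
κ-face-via _ _ (extreme _)    (extreme _)    (interior _ _) ()
κ-face-via _ _ (extreme _)    (interior _ _) (extreme _)    ()
κ-face-via _ _ (interior _ _) (extreme _)    (extreme _)    ()
κ-face-via _ _ (interior _ _) (interior _ _) (interior _ _) ()

∑-face-centre : ∀ {m x y} → 2 * x ≡ suc m → 2 * y ≡ suc m →
  ∑ m (λ k → interiorProfile m x k * interiorProfile m y k) ≡ 5 * m ∸ 4 ∸ (m ∸ 1) % 2
∑-face-centre {m} {x} {y} 2x≡1+m 2y≡1+m with *-cancelˡ-≡ y x 2 (trans 2y≡1+m (sym 2x≡1+m))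
... | refl with half {m} {x} 2x≡1+m
... | t , refl , refl = begin
  ∑ m (λ k → interiorProfile m (suc t) k * interiorProfile m (suc t) k)
    ≡⟨ ∑-cong m (λ k _ _ → cong₂ _*_ (interiorProfile-centre t k) (interiorProfile-centre t k)) ⟩
  ∑ m (λ k → f ⟦ k ≤ t ⟧)
    ≡⟨ ∑-threshold m t f (m≤n⇒m≤1+n (m≤m+n t t)) (s≤s z≤n) ⟩
  m * 1 + 8 * t
    ≡⟨ sym (m+n∸n≡m (m * 1 + 8 * t) 4) ⟩
  m * 1 + 8 * t + 4 ∸ 4
    ≡⟨ cong (_∸ 4) (five t) ⟩
  5 * m ∸ 4
    ≡⟨ cong (5 * m ∸ 4 ∸_) (sym (trans (cong (_% 2) (double t)) (m*n%n≡0 t 2))) ⟩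
  5 * m ∸ 4 ∸ (t + t) % 2
    ∎
  where
  open ≡-Reasoning
  f : ℕ → ℕ
  f l = (1 + (l + l)) * (1 + (l + l))
  five : ∀ t → suc (t + t) * 1 + 8 * t + 4 ≡ 5 * suc (t + t)
  five = solve-∀
  double : ∀ t → t + t ≡ t * 2
  double = solve-∀

κ-face : ∀ m q → InBoard (2 + m) q → numExtreme (2 + m) q ≡ 1 → κ (2 + m) q ≤ 5 * m ∸ 4 ∸ (m ∸ 1) % 2
κ-face m (x₁ , x₂ , x₃) (x₁< , x₂< , x₃<) one =
  κ-face-via (λ _ → ⊤) (_≤ 5 * m ∸ 4 ∸ (m ∸ 1) % 2)
    p₁ p₂ p₃ (trans (sym (numExtreme-positions p₁ p₂ p₃)) one) tt tt tt
    (λ {x} {y} 1≤x x≤m _ 1≤y y≤m _ → face-bound {m} {x} {y} 1≤x x≤m 1≤y y≤m)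
  where
  p₁ = position x₁<
  p₂ = position x₂<
  p₃ = position x₃<

κ-faceCentre : ∀ m q → InBoard (2 + m) q → IsFaceCentre (2 + m) q → κ (2 + m) q ≡ 5 * m ∸ 4 ∸ (m ∸ 1) % 2
κ-faceCentre m (x₁ , x₂ , x₃) (x₁< , x₂< , x₃<) (one , c₁ , c₂ , c₃) =
  κ-face-via (λ x → Extreme (2 + m) x ⊎ 2 * x ≡ suc m) (_≡ 5 * m ∸ 4 ∸ (m ∸ 1) % 2)
    p₁ p₂ p₃ (trans (sym (numExtreme-positions p₁ p₂ p₃)) one) c₁ c₂ c₃
    (λ {x} {y} 1≤x x≤m cx 1≤y y≤m cy → ∑-face-centre {m} {x} {y} (centred 1≤x x≤m cx) (centred 1≤y y≤m cy))
  where
  p₁ = position x₁<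
  p₂ = position x₂<
  p₃ = position x₃<
  centred : ∀ {x} → 1 ≤ x → x ≤ m → Extreme (2 + m) x ⊎ 2 * x ≡ suc m → 2 * x ≡ suc m
  centred 1≤x x≤m (inj₁ e) = ⊥-elim (interior⇒¬extreme 1≤x x≤m e)
  centred _   _   (inj₂ c) = c

κ-in-C : ∀ {m x₁ x₂ x₃} → InC (2 + m) (x₁ , x₂ , x₃) →
  κ (2 + m) (x₁ , x₂ , x₃) + m
  ≡ 1 + ∑ m (λ k → interiorProfile m x₁ k * interiorProfile m x₂ k * interiorProfile m x₃ k)
κ-in-C {m} {x₁} {x₂} {x₃} ((1≤x₁ , x₁≤m) , (1≤x₂ , x₂≤m) , (1≤x₃ , x₃≤m)) =
  trans (cong (_+_ (κ (2 + m) (x₁ , x₂ , x₃))) (sym (*-identityʳ m)))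
        (κ-positions (interior 1≤x₁ x₁≤m) (interior 1≤x₂ x₂≤m) (interior 1≤x₃ x₃≤m))

κ-inner : ∀ m q → InC (2 + m) q → κ (2 + m) q ≤ 13 * m ∸ 12
κ-inner zero    _ ((s≤s _ , ()) , _)
κ-inner (suc M) (x₁ , x₂ , x₃) q∈C@((1≤x₁ , x₁≤m) , (1≤x₂ , x₂≤m) , (1≤x₃ , x₃≤m)) =
  ≤-trans (+-cancelʳ-≤ (suc M) _ _ (begin
    κ (3 + M) q + suc M                     ≡⟨ κ-in-C q∈C ⟩
    1 + ∑ (suc M) (λ k → π x₁ k * π x₂ k * π x₃ k)
      ≤⟨ +-monoʳ-≤ 1 (∑-cube-bound (suc M) _ _ _ _ _ _ (A≤ x₁) (B≤ x₁≤m) (A≤ x₂) (B≤ x₂≤m) (A≤ x₃) (B≤ x₃≤m)) ⟩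
    1 + (suc M + 5 * S x₁ + 4 * S x₂ + 4 * S x₃)
      ≡⟨ cong (λ s → 1 + (suc M + 5 * s + 4 * S x₂ + 4 * S x₃)) (interior-split 1≤x₁ x₁≤m) ⟩
    1 + (suc M + 5 * M + 4 * S x₂ + 4 * S x₃)
      ≡⟨ cong₂ (λ s s′ → 1 + (suc M + 5 * M + 4 * s + 4 * s′)) (interior-split 1≤x₂ x₂≤m) (interior-split 1≤x₃ x₃≤m) ⟩
    1 + (suc M + 5 * M + 4 * M + 4 * M)     ≡⟨ regroup M ⟩
    1 + 13 * M + suc M                      ∎))
  (≤-reflexive (sym (trans (cong (_∸ 12) (thirteen M)) (m+n∸n≡m (1 + 13 * M) 12))))
  where
  open ≤-Reasoning
  q = (x₁ , x₂ , x₃)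
  π = interiorProfile (suc M)
  S : ℕ → ℕ
  S x = (suc M ∸ x) + (x ∸ 1)
  A≤ : ∀ x → suc M ∸ x ≤ suc M
  A≤ x = m∸n≤m (suc M) x
  B≤ : ∀ {x} → x ≤ suc M → x ∸ 1 ≤ suc M
  B≤ {x} x≤m = ≤-trans (m∸n≤m x 1) x≤m
  regroup : ∀ M → 1 + (suc M + 5 * M + 4 * M + 4 * M) ≡ 1 + 13 * M + suc M
  regroup = solve-∀
  thirteen : ∀ M → 13 * suc M ≡ 1 + 13 * M + 12
  thirteen = solve-∀

κ-centre : ∀ m c → 2 * c ≡ suc m → κ (2 + m) (c , c , c) ≡ 13 * m ∸ 12
κ-centre m c 2c≡1+m with half {m} {c} 2c≡1+m
... | t , refl , refl = trans (+-cancelʳ-≡ m _ _ (begin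
  κ (2 + m) (c , c , c) + m
    ≡⟨ κ-in-C c³∈C ⟩
  1 + ∑ m (λ k → π k * π k * π k)
    ≡⟨ cong suc (∑-cong m λ k _ _ → cong₂ _*_ (cong₂ _*_ (centre k) (centre k)) (centre k)) ⟩
  1 + ∑ m (λ k → f ⟦ k ≤ t ⟧)
    ≡⟨ cong suc (∑-threshold m t f (m≤n⇒m≤1+n (m≤m+n t t)) (s≤s z≤n)) ⟩
  1 + (m * 1 + 26 * t)
    ≡⟨ regroup t ⟩
  1 + 26 * t + m
    ∎))
  (sym (trans (cong (_∸ 12) (thirteen t)) (m+n∸n≡m (1 + 26 * t) 12)))
  where
  open ≡-Reasoning
  π = interiorProfile m c
  centre = interiorProfile-centre t
  f : ℕ → ℕ
  f l = (1 + (l + l)) * (1 + (l + l)) * (1 + (l + l))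
  c≤m : c ≤ m
  c≤m = s≤s (m≤m+n t t)
  c³∈C : InC (2 + m) (c , c , c)
  c³∈C = (s≤s z≤n , c≤m) , (s≤s z≤n , c≤m) , (s≤s z≤n , c≤m)
  regroup : ∀ t → 1 + (suc (t + t) * 1 + 26 * t) ≡ 1 + 26 * t + suc (t + t)
  regroup = solve-∀
  thirteen : ∀ t → 13 * suc (t + t) ≡ 1 + 26 * t + 12
  thirteen = solve-∀

κ-111 : ∀ M → κ (3 + M) (1 , 1 , 1) ≡ 1 + 7 * M
κ-111 M = +-cancelʳ-≡ (suc M) _ _ (begin
  κ (3 + M) (1 , 1 , 1) + suc M
    ≡⟨ κ-in-C 111∈C ⟩
  1 + ∑ (suc M) (λ k → π k * π k * π k)
    ≡⟨ cong suc (∑-cong (suc M) λ k 1≤k _ → cong (f′ ⟦ k ≤ M ⟧) (ind-no (k ≤? 0) (<⇒≱ 1≤k))) ⟩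
  1 + ∑ (suc M) (λ k → f ⟦ k ≤ M ⟧)
    ≡⟨ cong suc (∑-threshold (suc M) M f (n≤1+n M) (s≤s z≤n)) ⟩
  1 + (suc M * 1 + 7 * M)
    ≡⟨ regroup M ⟩
  1 + 7 * M + suc M
    ∎)
  where
  open ≡-Reasoning
  π = interiorProfile (suc M) 1
  f′ : ℕ → ℕ → ℕ
  f′ a b = (1 + (a + b)) * (1 + (a + b)) * (1 + (a + b))
  f : ℕ → ℕ
  f a = f′ a 0
  111∈C : InC (3 + M) (1 , 1 , 1)
  111∈C = (≤-refl , s≤s z≤n) , (≤-refl , s≤s z≤n) , (≤-refl , s≤s z≤n)
  regroup : ∀ M → 1 + (suc M * 1 + 7 * M) ≡ 1 + 7 * M + suc M
  regroup = solve-∀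

boundary-cases : ∀ m q → InBoard (2 + m) q → ¬ InC (2 + m) q →
  Corner (2 + m) q ⊎ numExtreme (2 + m) q ≡ 2 ⊎ numExtreme (2 + m) q ≡ 1
boundary-cases m (x₁ , x₂ , x₃) (x₁< , x₂< , x₃<) q∉C = cases (position x₁<) (position x₂<) (position x₃<)
  where
  cases : (p₁ : Position m x₁) (p₂ : Position m x₂) (p₃ : Position m x₃) →
    Corner (2 + m) (x₁ , x₂ , x₃) ⊎ numExtreme (2 + m) (x₁ , x₂ , x₃) ≡ 2 ⊎ numExtreme (2 + m) (x₁ , x₂ , x₃) ≡ 1
  cases (extreme e₁) (extreme e₂) (extreme e₃) = inj₁ (e₁ , e₂ , e₃)
  cases p₁@(extreme _)    p₂@(extreme _)    p₃@(interior _ _) = inj₂ (inj₁ (numExtreme-positions p₁ p₂ p₃))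
  cases p₁@(extreme _)    p₂@(interior _ _) p₃@(extreme _)    = inj₂ (inj₁ (numExtreme-positions p₁ p₂ p₃))
  cases p₁@(interior _ _) p₂@(extreme _)    p₃@(extreme _)    = inj₂ (inj₁ (numExtreme-positions p₁ p₂ p₃))
  cases p₁@(extreme _)    p₂@(interior _ _) p₃@(interior _ _) = inj₂ (inj₂ (numExtreme-positions p₁ p₂ p₃))
  cases p₁@(interior _ _) p₂@(extreme _)    p₃@(interior _ _) = inj₂ (inj₂ (numExtreme-positions p₁ p₂ p₃))
  cases p₁@(interior _ _) p₂@(interior _ _) p₃@(extreme _)    = inj₂ (inj₂ (numExtreme-positions p₁ p₂ p₃))
  cases (interior 1≤x₁ x₁≤m) (interior 1≤x₂ x₂≤m) (interior 1≤x₃ x₃≤m) =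
    ⊥-elim (q∉C ((1≤x₁ , x₁≤m) , (1≤x₂ , x₂≤m) , (1≤x₃ , x₃≤m)))

κ-boundary≤ : ∀ M q → InBoard (3 + M) q → ¬ InC (3 + M) q → κ (3 + M) q ≤ 1 + 5 * M
κ-boundary≤ M q q∈ q∉C = [ corner , [ edge , face ]′ ]′ (boundary-cases (suc M) q q∈ q∉C)
  where
  corner : Corner (3 + M) q → κ (3 + M) q ≤ 1 + 5 * M
  corner c = ≤-trans (≤-reflexive (κ-corner (suc M) q c)) (s≤s (m≤m+n M (4 * M)))
  twice : ∀ M → M + (suc M + 0) ≡ 1 + (M + M)
  twice = solve-∀
  edge : numExtreme (3 + M) q ≡ 2 → κ (3 + M) q ≤ 1 + 5 * M
  edge two = ≤-trans (≤-reflexive (trans (κ-edge (suc M) q q∈ two) (twice M))) (s≤s (+-monoʳ-≤ M (m≤m+n M (3 * M))))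
  five : ∀ M → 5 * suc M ≡ 1 + 5 * M + 4
  five = solve-∀
  face : numExtreme (3 + M) q ≡ 1 → κ (3 + M) q ≤ 1 + 5 * M
  face one = ≤-trans (κ-face (suc M) q q∈ one)
                     (≤-trans (m∸n≤m _ (M % 2)) (≤-reflexive (trans (cong (_∸ 4) (five M)) (m+n∸n≡m (1 + 5 * M) 4))))

κ-boundary<κ-111 : ∀ m → 2 ≤ m → ∀ q → InBoard (2 + m) q → ¬ InC (2 + m) q → κ (2 + m) q < κ (2 + m) (1 , 1 , 1)
κ-boundary<κ-111 (suc (suc M)) (s≤s (s≤s z≤n)) q q∈ q∉C = begin-strict
  κ (4 + M) q           ≤⟨ κ-boundary≤ (suc M) q q∈ q∉C ⟩
  1 + 5 * suc M         <⟨ m<m+n (1 + 5 * suc M) (s≤s z≤n) ⟩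
  1 + 5 * suc M + (2 + 2 * M) ≡⟨ regroup M ⟩
  1 + 7 * suc M         ≡⟨ sym (κ-111 (suc M)) ⟩
  κ (4 + M) (1 , 1 , 1) ∎
  where
  open ≤-Reasoning
  regroup : ∀ M → 1 + 5 * suc M + (2 + 2 * M) ≡ 1 + 7 * suc M
  regroup = solve-∀

theorem2 : ∀ (n : ℕ) → 4 ≤ n →
    let m = n ∸ 2 in
    -- (i) corners
    (∀ q → InBoard n q → Corner n q → κ n q ≡ m)
    -- (ii) non-corner edge vertices
    × (∀ q → InBoard n q → numExtreme n q ≡ 2 → κ n q ≡ 2 * m ∸ 1)
    -- (iii) face vertices not on an edge
    × (∀ q → InBoard n q → numExtreme n q ≡ 1 → κ n q ≤ 5 * m ∸ 4 ∸ (m ∸ 1) % 2)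
    × (∀ q → InBoard n q → IsFaceCentre n q → κ n q ≡ 5 * m ∸ 4 ∸ (m ∸ 1) % 2)
    × ((∃[ c ] 2 * c ≡ n ∸ 1) ⇔ (m % 2 ≡ 1))
    -- (iv) points of C
    × (∀ q → InC n q → κ n q ≤ 13 * m ∸ 12)
    × (∀ c → 2 * c ≡ n ∸ 1 → κ n (c , c , c) ≡ 13 * m ∸ 12)
    -- max over the boundary < max over C
    × (∃[ q ] (InC n q × (∀ p → InBoard n p → ¬ InC n p → κ n p < κ n q)))
theorem2 (suc (suc m)) (s≤s (s≤s 2≤m)) =
    (λ q _ → κ-corner m q)
  , κ-edge m
  , κ-face m
  , κ-faceCentre m
  , lattice-centre⇔odd m
  , κ-inner m
  , κ-centre m
  , (1 , 1 , 1) , (one , one , one) , κ-boundary<κ-111 m 2≤m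
  where
  one : 1 ≤ 1 × 1 ≤ m
  one = ≤-refl , <⇒≤ 2≤m
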